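{- Let $m=(p-1)/2$ and $n=(q-1)/2$. For every $U\in\mathrm{U}(1)^g$, the characteristic polynomial of $U\gamma_p^{m}\gamma_q^{n}$ is $(T^2+1)^g$.
   Context: Let $p\neq q$ be odd primes and $g=(p-1)(q-1)/2$. $J=\begin{pmatrix}0&1\\-1&0\end{pmatrix}$, $I$ the $2\times2$ identity; $\mathrm{U}(1)^g$ is the group of $\mathrm{diag}(u_1,\overline{u_1},\dots,u_g,\overline{u_g})$ with $u_i\in\mathbb{C}$, $|u_i|=1$. Notation: $\langle x\rangle_r$ is the representative of $x$ mod $r$ in $\{0,\dots,r-1\}$. For $1\le b\le q-1$ let $k_b=\lfloor (pb-q-1)/q\rfloor$; for $0\le t\le q-1$ let $\kappa_t=\sum_{1\le b\le t,\ k_b\ge0}(k_b+1)$. The integer pairs $(a,b)$ with $1\le b\le q-1$, $0\le a\le k_b$ number exactly $g$; order them by increasing $b$ then increasing $a$ and let $(a_i,b_i)$ be the $i$-th pair. A $2g\times2g$ matrix $X$ has $2\times2$ blocks $X[i,j]$. Fix generators $c$ of $(\mathbb{Z}/p\mathbb{Z})^\times$ and $d$ of $(\mathbb{Z}/q\mathbb{Z})^\times$. $\gamma_q$: with $t_i=\langle db_i\rangle_q$, $t_i'=q-t_i$, $\gamma_q[i,j]=I$ if $0\le a_i\le k_{t_i}$ and $j=\kappa_{t_i-1}+a_i+1$; $=J$ if $a_i>k_{t_i}$ and $j=\kappa_{t_i'-1}+p-(a_i+1)$; $=0$ otherwise. $\gamma_p$: with $s_i=\langle c(a_i+1)\rangle_p-1$,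 $b_i'=q-b_i$, $\gamma_p[i,j]=I$ if $0\le s_i\le k_{b_i}$ and $j=\kappa_{b_i-1}+s_i+1$; $=J$ if $s_i>k_{b_i}$ and $j=\kappa_{b_i'-1}+p-(s_i+1)$; $=0$ otherwise. (These, with $\mathrm{U}(1)^g$, generate the Sato–Tate group of the Jacobian of $y^q=x^p-1$.) -}

module Defs where

open import Level using (Level)
open import Data.Bool using (Bool; true; false; if_then_else_; _∧_)
open import Data.Nat as ℕ using (ℕ; zero; suc; _∸_; _≡ᵇ_; _<ᵇ_; _≤_; _<_)
open import Data.Nat.DivMod using (_%_; _/_)
open import Data.Product using (_×_; _,_; proj₁; proj₂; ∃-syntax)
open import Data.List using (List; []; _∷_; map; concat; upTo)
open import Relation.Binary.PropositionalEquality using (_≡_)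
open import Algebra.Bundles using (CommutativeRing)

-- x mod r and x div r (for r > 0; the value at r = 0 is irrelevant)
_%′_ : ℕ → ℕ → ℕ
x %′ zero  = x
x %′ suc r = x % suc r

_/′_ : ℕ → ℕ → ℕ
x /′ zero  = zero
x /′ suc r = x / suc r

sumTo : ∀ {a} {A : Set a} → (A → A → A) → A → ℕ → (ℕ → A) → A
sumTo _⊕_ e zero    f = e
sumTo _⊕_ e (suc n) f = sumTo _⊕_ e n f ⊕ f n

sumℕ : ℕ → (ℕ → ℕ) → ℕ
sumℕ = sumTo ℕ._+_ 0

nth : ∀ {a} {A : Set a} → A → List A → ℕ → A
nth d []       _       = d
nth d (x ∷ xs) zero    = x
nth d (x ∷ xs) (suc i) = nth d xs i

Odd : ℕ → Set
Odd p = p %′ 2 ≡ 1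

IsGenerator : ℕ → ℕ → Set
IsGenerator p c = ∀ x → 1 ≤ x → x < p → ∃[ k ] ((c ℕ.^ k) %′ p ≡ x)

module Data (p q : ℕ) where

  g : ℕ
  g = ((p ∸ 1) ℕ.* (q ∸ 1)) /′ 2

  m : ℕ
  m = (p ∸ 1) /′ 2

  n : ℕ
  n = (q ∸ 1) /′ 2

  -- cnt b = #{ a | 0 ≤ a ≤ k_b } = max(0, k_b + 1) = ⌊(p b - 1)/q⌋,
  -- where k_b = ⌊(p b - q - 1)/q⌋ ≥ -1.
  -- Thus "0 ≤ a ≤ k_b"  ⇔  a < cnt b   and   "a > k_b" ⇔ cnt b ≤ a.
  cnt : ℕ → ℕ
  cnt b = (p ℕ.* b ∸ 1) /′ q

  κ : ℕ → ℕ
  κ t = sumℕ t (λ i → cnt (suc i))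

  pairs : List (ℕ × ℕ)
  pairs = concat (map (λ b → map (λ a → (a , b)) (upTo (cnt b)))
                      (map suc (upTo (q ∸ 1))))

  -- (a_i , b_i) for 1 ≤ i ≤ g
  pair : ℕ → ℕ × ℕ
  pair i = nth (0 , 0) pairs (i ∸ 1)

  aᵢ bᵢ : ℕ → ℕ
  aᵢ i = proj₁ (pair i)
  bᵢ i = proj₂ (pair i)

  data Block : Set where
    𝟘 𝕀 𝕁 : Block

  -- γ_q[i , j]  (1-based block indices), for the generator d of (ℤ/qℤ)^×
  γq-block : ℕ → ℕ → ℕ → Block
  γq-block d i j =
    let a  = aᵢ i
        t  = (d ℕ.* bᵢ i) %′ q
        t' = q ∸ t
    in if a <ᵇ cnt t
       then (if j ≡ᵇ (κ (t ∸ 1) ℕ.+ a ℕ.+ 1) then 𝕀 else 𝟘)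
       else (if j ≡ᵇ (κ (t' ∸ 1) ℕ.+ (p ∸ (a ℕ.+ 1))) then 𝕁 else 𝟘)

  -- γ_p[i , j]  (1-based block indices), for the generator c of (ℤ/pℤ)^×
  -- s_i = ⟨c(a_i+1)⟩_p - 1 ; if ⟨c(a_i+1)⟩_p = 0 then s_i = -1 and the
  -- block is 0 (never happens for a generator c).
  γp-block : ℕ → ℕ → ℕ → Block
  γp-block c i j =
    let a  = aᵢ i
        b  = bᵢ i
        r  = (c ℕ.* (a ℕ.+ 1)) %′ p
        s  = r ∸ 1
        b' = q ∸ b
    in if r ≡ᵇ 0 then 𝟘 else
       (if s <ᵇ cnt b
        then (if j ≡ᵇ (κ (b ∸ 1) ℕ.+ s ℕ.+ 1) then 𝕀 else 𝟘)
        else (if j ≡ᵇ (κ (b' ∸ 1) ℕ.+ (p ∸ (s ℕ.+ 1))) then 𝕁 else 𝟘))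

module OverRing {c ℓ : Level} (R : CommutativeRing c ℓ) where
  open CommutativeRing R

  -- square matrices of size N are functions ℕ → ℕ → Carrier
  -- (only entries with indices < N matter); indices are 0-based.
  Mat : Set c
  Mat = ℕ → ℕ → Carrier

  module Generic {a} {A : Set a}
                 (_⊕_ _⊗_ : A → A → A) (⊖_ : A → A) (z o : A) where

    Σ< : ℕ → (ℕ → A) → A
    Σ< = sumTo _⊕_ z

    sgn : ℕ → A → A
    sgn zero          x = x
    sgn (suc zero)    x = ⊖ x
    sgn (suc (suc j)) x = sgn j x

    minor : ℕ → (ℕ → ℕ → A) → (ℕ → ℕ → A)
    minor j M r k = M (suc r) (if k <ᵇ j then k else suc k)

    det : ℕ → (ℕ → ℕ → A) → A
    det zero    M = o
    det (suc N) M = Σ< (suc N) (λ j → sgn j (M 0 j ⊗ det N (minor j M)))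

    mul : ℕ → (ℕ → ℕ → A) → (ℕ → ℕ → A) → (ℕ → ℕ → A)
    mul N A B i j = Σ< N (λ k → A i k ⊗ B k j)

    idM : ℕ → ℕ → A
    idM i j = if i ≡ᵇ j then o else z

    pow : ℕ → (ℕ → ℕ → A) → ℕ → (ℕ → ℕ → A)
    pow N A zero    = idM
    pow N A (suc k) = mul N (pow N A k) A

  open Generic _+_ _*_ -_ 0# 1# public

  -- Polynomials in T over R, as coefficient sequences (coefficient of T^k)

  Poly : Set c
  Poly = ℕ → Carrier

  _+ₚ_ : Poly → Poly → Poly
  (f +ₚ h) k = f k + h k

  _*ₚ_ : Poly → Poly → Poly
  (f *ₚ h) k = Σ< (suc k) (λ i → f i * h (k ∸ i))

  -ₚ_ : Poly → Poly
  (-ₚ f) k = - f k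

  constₚ : Carrier → Poly
  constₚ x zero    = x
  constₚ x (suc k) = 0#

  0ₚ 1ₚ Tₚ : Poly
  0ₚ = constₚ 0#
  1ₚ = constₚ 1#
  Tₚ zero          = 0#
  Tₚ (suc zero)    = 1#
  Tₚ (suc (suc k)) = 0#

  _^ₚ_ : Poly → ℕ → Poly
  f ^ₚ zero  = 1ₚ
  f ^ₚ suc k = (f ^ₚ k) *ₚ f

  module P = Generic _+ₚ_ _*ₚ_ -ₚ_ 0ₚ 1ₚ

  charPoly : ℕ → Mat → Poly
  charPoly N M = P.det N (λ i j → (if i ≡ᵇ j then Tₚ else 0ₚ) +ₚ (-ₚ constₚ (M i j)))

  _≈ₚ_ : Poly → Poly → Set ℓ
  f ≈ₚ h = ∀ k → f k ≈ h k

  module Mats (p q : ℕ) where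
    open Data p q public

    blockEntry : Block → ℕ → ℕ → Carrier
    blockEntry 𝟘 x y = 0#
    blockEntry 𝕀 x y = if x ≡ᵇ y then 1# else 0#
    blockEntry 𝕁 x y = if (x ≡ᵇ 0) ∧ (y ≡ᵇ 1) then 1#
                       else (if (x ≡ᵇ 1) ∧ (y ≡ᵇ 0) then - 1#
                       else 0#)

    fromBlocks : (ℕ → ℕ → Block) → Mat
    fromBlocks B r s =
      blockEntry (B (suc (r /′ 2)) (suc (s /′ 2))) (r %′ 2) (s %′ 2)

    γq : ℕ → Mat
    γq d = fromBlocks (γq-block d)

    γp : ℕ → Mat
    γp c = fromBlocks (γp-block c)

    -- U = diag(u_1, v_1, …, u_g, v_g)   (u, v indexed 0-based here)
    diagU : (ℕ → Carrier) → (ℕ → Carrier) → Mat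
    diagU u v r s = if r ≡ᵇ s
                    then (if r %′ 2 ≡ᵇ 0 then u (r /′ 2) else v (r /′ 2))
                    else 0#

    dim : ℕ
    dim = 2 ℕ.* g

    theMatrix : ℕ → ℕ → (ℕ → Carrier) → (ℕ → Carrier) → Mat
    theMatrix c d u v =
      mul (2 ℕ.* g) (mul (2 ℕ.* g) (diagU u v) (pow (2 ℕ.* g) (γp c) m))
                    (pow (2 ℕ.* g) (γq d) n)

module Submission where

-- Index the 2g block rows by the lattice points (x , y) with 0 < x < p, 0 < y < q, taken up to
-- the point reflection (x , y) ↦ (p - x , q - y): exactly one of the two points lies above the
-- diagonal q x = p y. Then γ_p and γ_q are block monomial matrices with blocks ±I and ±J: γ_p moves
-- the block of (x , y) to that of (c x , y), γ_q to that of (x , d y), with a J exactly when the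
-- point changes side of the diagonal. As c^m ≡ -1 (mod p) and d^n ≡ -1 (mod q), the product
-- γ_p^m γ_q^n maps the block of (x , y) to the block of (p - x , q - y), which is the same block,
-- and since these two points lie on opposite sides of the diagonal it picks up an odd number of
-- J's. So U γ_p^m γ_q^n is block diagonal with antidiagonal 2×2 blocks whose two entries multiply
-- to -u v = -1, each contributing a factor T² + 1 to the characteristic polynomial.

open import Defs
open import Level using (Level; _⊔_)
open import Algebra.Bundles using (CommutativeRing)
open import Data.Nat using (ℕ; zero; suc; _<_)
open import Data.Nat.Primality using (Prime; ¬prime[0])
open import Data.Empty using (⊥-elim)
open import Relation.Binary.PropositionalEquality using (_≢_)

module Arithmetic where
  open import Data.Bool using (true; false)
  open import Data.Bool.Properties using (T-≡)
  open import Data.Nat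
  open import Data.Nat.Properties
  open import Data.Nat.DivMod
  open import Data.Nat.Primality
  open import Data.List using (List; []; _∷_; _++_; length; concat; applyUpTo)
  open import Data.Product using (_×_; _,_; ∃-syntax)
  open import Data.Empty using (⊥-elim)
  open import Function using (_∘_; Equivalence)
  open import Relation.Binary.PropositionalEquality
  open import Relation.Nullary using (¬_; yes; no; contradiction)

  ≡ᵇ-refl : ∀ n → (n ≡ᵇ n) ≡ true
  ≡ᵇ-refl n = Equivalence.to T-≡ (≡⇒≡ᵇ n n refl)

  ≡ᵇ-≢ : ∀ m n → m ≢ n → (m ≡ᵇ n) ≡ false
  ≡ᵇ-≢ zero    zero    m≢n = contradiction refl m≢n
  ≡ᵇ-≢ zero    (suc n) m≢n = refl
  ≡ᵇ-≢ (suc m) zero    m≢n = refl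
  ≡ᵇ-≢ (suc m) (suc n) m≢n = ≡ᵇ-≢ m n (λ m≡n → m≢n (cong suc m≡n))

  ≡ᵇ-sym : ∀ m n → (m ≡ᵇ n) ≡ (n ≡ᵇ m)
  ≡ᵇ-sym zero    zero    = refl
  ≡ᵇ-sym zero    (suc n) = refl
  ≡ᵇ-sym (suc m) zero    = refl
  ≡ᵇ-sym (suc m) (suc n) = ≡ᵇ-sym m n

  ≡ᵇ-true⇒≡ : ∀ m n → (m ≡ᵇ n) ≡ true → m ≡ n
  ≡ᵇ-true⇒≡ m n eq = ≡ᵇ⇒≡ m n (Equivalence.from T-≡ eq)

  odd⇒half+half : ∀ n → Odd n → (n ∸ 1) /′ 2 + (n ∸ 1) /′ 2 ≡ n ∸ 1
  odd⇒half+half n odd = begin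
    (n ∸ 1) / 2 + (n ∸ 1) / 2 ≡⟨ cong (λ k → k / 2 + k / 2) n∸1≡h*2 ⟩
    h * 2 / 2 + h * 2 / 2     ≡⟨ cong₂ _+_ (m*n/n≡m h 2) (m*n/n≡m h 2) ⟩
    h + h                     ≡⟨ trans (*-comm h 2) (cong (h +_) (+-identityʳ h)) ⟨
    h * 2                     ≡⟨ n∸1≡h*2 ⟨
    n ∸ 1                     ∎
    where
    open ≡-Reasoning
    h = n / 2
    n∸1≡h*2 : n ∸ 1 ≡ h * 2
    n∸1≡h*2 = cong (_∸ 1) (trans (m≡m%n+[m/n]*n n 2) (cong (_+ h * 2) odd))

  odd-prime⇒2< : ∀ {p} → Prime p → Odd p → 2 < p
  odd-prime⇒2< {p} p-prime p-odd = ≤∧≢⇒< (nonTrivial⇒n>1 p {{prime⇒nonTrivial p-prime}}) 2≢p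
    where
    2≢p : 2 ≢ p
    2≢p refl = 0≢1+n p-odd

  <ᵇ-true : ∀ {m n} → m < n → (m <ᵇ n) ≡ true
  <ᵇ-true m<n = Equivalence.to T-≡ (<⇒<ᵇ m<n)

  <ᵇ-false : ∀ {m n} → ¬ m < n → (m <ᵇ n) ≡ false
  <ᵇ-false {m} {n} m≮n with m <ᵇ n in m<ᵇn
  ... | false = refl
  ... | true  = ⊥-elim (m≮n (<ᵇ⇒< m n (Equivalence.from T-≡ m<ᵇn)))

  <ᵇ⇔ : ∀ {a b c d} → (a < b → c < d) → (c < d → a < b) → (a <ᵇ b) ≡ (c <ᵇ d)
  <ᵇ⇔ {a} {b} to from with a <? b
  ... | yes a<b = trans (<ᵇ-true a<b) (sym (<ᵇ-true (to a<b)))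
  ... | no  a≮b = trans (<ᵇ-false a≮b) (sym (<ᵇ-false (a≮b ∘ from)))

  <⇒≤∸1 : ∀ {a b} → a < b → a ≤ b ∸ 1
  <⇒≤∸1 {b = suc b} (s≤s a≤b) = a≤b

  ≤∸1⇒< : ∀ {a b} → 1 ≤ a → a ≤ b ∸ 1 → a < b
  ≤∸1⇒< {b = zero}  1≤a a≤0 = ⊥-elim (<⇒≱ 1≤a a≤0)
  ≤∸1⇒< {b = suc b} _   a≤b = s≤s a≤b

  open import Algebra.Properties.CommutativeSemigroup +-commutativeSemigroup
    using () renaming (interchange to +-interchange) public

  sumℕ-cong : ∀ n {f h} → (∀ i → i < n → f i ≡ h i) → sumℕ n f ≡ sumℕ n h
  sumℕ-cong zero    f≡h = refl
  sumℕ-cong (suc n) f≡h = cong₂ _+_ (sumℕ-cong n (λ i i<n → f≡h i (m≤n⇒m≤1+n i<n))) (f≡h n ≤-refl)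

  sumℕ-head : ∀ n f → sumℕ (suc n) f ≡ f 0 + sumℕ n (f ∘ suc)
  sumℕ-head zero    f = +-comm 0 (f 0)
  sumℕ-head (suc n) f = trans (cong (_+ f (suc n)) (sumℕ-head n f)) (+-assoc (f 0) _ _)

  sumℕ-mono : ∀ {n m} f → n ≤ m → sumℕ n f ≤ sumℕ m f
  sumℕ-mono f n≤m = mono (≤⇒≤′ n≤m)
    where
    mono : ∀ {n m} → n ≤′ m → sumℕ n f ≤ sumℕ m f
    mono ≤′-refl        = ≤-refl
    mono (≤′-step n≤′m) = ≤-trans (mono n≤′m) (m≤m+n _ _)

  sumℕ-distrib-+ : ∀ n f h → sumℕ n (λ i → f i + h i) ≡ sumℕ n f + sumℕ n h
  sumℕ-distrib-+ zero    f h = refl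
  sumℕ-distrib-+ (suc n) f h =
    trans (cong (_+ (f n + h n)) (sumℕ-distrib-+ n f h)) (+-interchange (sumℕ n f) (sumℕ n h) (f n) (h n))

  sumℕ-const : ∀ n k → sumℕ n (λ _ → k) ≡ n * k
  sumℕ-const zero    k = refl
  sumℕ-const (suc n) k = trans (cong (_+ k) (sumℕ-const n k)) (+-comm (n * k) k)

  sumℕ-reverse : ∀ n f → sumℕ n f ≡ sumℕ n (λ i → f (n ∸ suc i))
  sumℕ-reverse zero    f = refl
  sumℕ-reverse (suc n) f = begin
    sumℕ (suc n) f                               ≡⟨ sumℕ-head n f ⟩
    f 0 + sumℕ n (f ∘ suc)                       ≡⟨ cong (f 0 +_) (sumℕ-reverse n (f ∘ suc)) ⟩
    f 0 + sumℕ n (λ i → f (suc (n ∸ suc i)))     ≡⟨ cong (f 0 +_) (sumℕ-cong n (λ i i<n → cong f (sym (+-∸-assoc 1 i<n)))) ⟩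
    f 0 + sumℕ n (λ i → f (suc n ∸ suc i))       ≡⟨ +-comm (f 0) _ ⟩
    sumℕ n (λ i → f (suc n ∸ suc i)) + f 0       ≡⟨ cong (λ z → sumℕ n (λ i → f (suc n ∸ suc i)) + f z) (sym (n∸n≡0 n)) ⟩
    sumℕ (suc n) (λ i → f (suc n ∸ suc i))       ∎
    where open ≡-Reasoning

  sumℕ-decompose : ∀ n f {i} → i < sumℕ n f → ∃[ j ] ∃[ a ] j < n × a < f j × i ≡ sumℕ j f + a
  sumℕ-decompose zero    f ()
  sumℕ-decompose (suc n) f {i} i<Σ with i <? f 0
  ... | yes i<f0 = 0 , i , s≤s z≤n , i<f0 , refl
  ... | no  i≮f0 with sumℕ-decompose n (f ∘ suc) {i ∸ f 0}
                        (+-cancelˡ-< (f 0) _ _ (subst₂ _<_ (sym (m+[n∸m]≡n (≮⇒≥ i≮f0))) (sumℕ-head n f) i<Σ))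
  ...   | j , a , j<n , a<f , i∸f0≡ = suc j , a , s≤s j<n , a<f , (begin
    i                               ≡⟨ m+[n∸m]≡n (≮⇒≥ i≮f0) ⟨
    f 0 + (i ∸ f 0)                 ≡⟨ cong (f 0 +_) i∸f0≡ ⟩
    f 0 + (sumℕ j (f ∘ suc) + a)    ≡⟨ +-assoc (f 0) _ a ⟨
    f 0 + sumℕ j (f ∘ suc) + a      ≡⟨ cong (_+ a) (sumℕ-head j f) ⟨
    sumℕ (suc j) f + a              ∎)
    where open ≡-Reasoning

  module _ {A : Set} (d : A) where

    nth-++ˡ : ∀ xs ys {i} → i < length xs → nth d (xs ++ ys) i ≡ nth d xs i
    nth-++ˡ (x ∷ xs) ys {zero}  _         = refl
    nth-++ˡ (x ∷ xs) ys {suc i} (s≤s i<n) = nth-++ˡ xs ys i<n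

    nth-++ʳ : ∀ xs ys k → nth d (xs ++ ys) (length xs + k) ≡ nth d ys k
    nth-++ʳ []       ys k = refl
    nth-++ʳ (x ∷ xs) ys k = nth-++ʳ xs ys k

    nth-applyUpTo : ∀ (f : ℕ → A) n {i} → i < n → nth d (applyUpTo f n) i ≡ f i
    nth-applyUpTo f (suc n) {zero}  _         = refl
    nth-applyUpTo f (suc n) {suc i} (s≤s i<n) = nth-applyUpTo (f ∘ suc) n i<n

    nth-concat : ∀ (F : ℕ → List A) n {j a} → j < n → a < length (F j) →
                 nth d (concat (applyUpTo F n)) (sumℕ j (length ∘ F) + a) ≡ nth d (F j) a
    nth-concat F (suc n) {zero}  {a} _         a<len = nth-++ˡ (F 0) _ a<len
    nth-concat F (suc n) {suc j} {a} (s≤s j<n) a<len = begin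
      nth d (F 0 ++ rest) (sumℕ (suc j) (length ∘ F) + a)                 ≡⟨ cong (nth d (F 0 ++ rest)) index ⟩
      nth d (F 0 ++ rest) (length (F 0) + (sumℕ j (length ∘ F ∘ suc) + a)) ≡⟨ nth-++ʳ (F 0) rest _ ⟩
      nth d rest (sumℕ j (length ∘ F ∘ suc) + a)                           ≡⟨ nth-concat (F ∘ suc) n j<n a<len ⟩
      nth d (F (suc j)) a                                                  ∎
      where
      open ≡-Reasoning
      rest  = concat (applyUpTo (F ∘ suc) n)
      index : sumℕ (suc j) (length ∘ F) + a ≡ length (F 0) + (sumℕ j (length ∘ F ∘ suc) + a)
      index = trans (cong (_+ a) (sumℕ-head j (length ∘ F))) (+-assoc (length (F 0)) _ a)

module BlockIndexing where
  open import Data.Bool using (Bool; true; false; not; if_then_else_; _∧_)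
  open import Data.Nat as ℕ using (ℕ; zero; suc; _≡ᵇ_; _<_; z≤n; s≤s)
  open import Data.Nat.Properties using (suc-injective; +-suc)
  open import Data.Nat.DivMod using (m/n≡1+[m∸n]/n)
  open import Data.Product using (_,_; ∃-syntax)
  open import Relation.Binary.PropositionalEquality using (_≡_; _≢_; refl; trans; cong)

  blockRow : ℕ → Bool → ℕ
  blockRow zero    δ = if δ then 1 else 0
  blockRow (suc i) δ = suc (suc (blockRow i δ))

  blockRow< : ∀ {k i} δ → i < k → blockRow i δ < 2 ℕ.* k
  blockRow< {suc k} {zero} false _ = s≤s z≤n
  blockRow< {suc k} {zero} true _ rewrite +-suc k (k ℕ.+ 0) = s≤s (s≤s z≤n)
  blockRow< {suc k} {suc i} δ (s≤s i<k) rewrite +-suc k (k ℕ.+ 0) = s≤s (s≤s (blockRow< δ i<k))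

  blockRow/2 : ∀ i δ → blockRow i δ /′ 2 ≡ i
  blockRow/2 zero    false = refl
  blockRow/2 zero    true  = refl
  blockRow/2 (suc i) δ     =
    trans (m/n≡1+[m∸n]/n {suc (suc (blockRow i δ))} {2} (s≤s (s≤s z≤n))) (cong suc (blockRow/2 i δ))

  blockRow%2 : ∀ i δ → blockRow i δ %′ 2 ≡ blockRow 0 δ
  blockRow%2 zero    false = refl
  blockRow%2 zero    true  = refl
  blockRow%2 (suc i) δ     = blockRow%2 i δ

  blockRow-surjective : ∀ s → ∃[ i ] ∃[ δ ] s ≡ blockRow i δ
  blockRow-surjective zero          = 0 , false , refl
  blockRow-surjective (suc zero)    = 0 , true , refl
  blockRow-surjective (suc (suc s)) with blockRow-surjective s
  ... | i , δ , refl = suc i , δ , refl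

  blockRow-≢-not : ∀ i δ → blockRow i δ ≢ blockRow i (not δ)
  blockRow-≢-not zero    false ()
  blockRow-≢-not zero    true  ()
  blockRow-≢-not (suc i) δ eq = blockRow-≢-not i δ (suc-injective (suc-injective eq))

  blockRow-≡ᵇ : ∀ i ε j δ → (blockRow i ε ≡ᵇ blockRow j δ) ≡ ((i ≡ᵇ j) ∧ (if ε then δ else not δ))
  blockRow-≡ᵇ zero    false zero    false = refl
  blockRow-≡ᵇ zero    false zero    true  = refl
  blockRow-≡ᵇ zero    true  zero    false = refl
  blockRow-≡ᵇ zero    true  zero    true  = refl
  blockRow-≡ᵇ zero    false (suc j) δ     = refl
  blockRow-≡ᵇ zero    true  (suc j) false = refl
  blockRow-≡ᵇ zero    true  (suc j) true  = refl
  blockRow-≡ᵇ (suc i) false zero    false = refl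
  blockRow-≡ᵇ (suc i) false zero    true  = refl
  blockRow-≡ᵇ (suc i) true  zero    false = refl
  blockRow-≡ᵇ (suc i) true  zero    true  = refl
  blockRow-≡ᵇ (suc i) ε     (suc j) δ     = blockRow-≡ᵇ i ε j δ

module BooleanSigns where
  open import Data.Bool using (true; false; _∧_; _xor_)
  open import Data.Bool.Properties using (xor-∧-commutativeRing; xor-assoc; xor-same)
  open import Relation.Binary.PropositionalEquality using (_≡_; refl; sym; cong; module ≡-Reasoning)

  xor-telescope : ∀ a b c → (a xor b) xor (b xor c) ≡ a xor c
  xor-telescope a b c = begin
    (a xor b) xor (b xor c) ≡⟨ xor-assoc a b (b xor c) ⟩
    a xor (b xor (b xor c)) ≡⟨ cong (a xor_) (sym (xor-assoc b b c)) ⟩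
    a xor ((b xor b) xor c) ≡⟨ cong (λ z → a xor (z xor c)) (xor-same b) ⟩
    a xor c                 ∎
    where open ≡-Reasoning

  -- In row δ, J^f₁ J^f₂ = (-1)^(f₁ ∧ f₂) J^(f₁ xor f₂), using J² = -I.
  J-sign : ∀ f₁ f₂ δ → (f₁ ∧ δ) xor (f₂ ∧ (δ xor f₁)) ≡ (f₁ ∧ f₂) xor ((f₁ xor f₂) ∧ δ)
  J-sign false false false = refl
  J-sign false false true  = refl
  J-sign false true  false = refl
  J-sign false true  true  = refl
  J-sign true  false false = refl
  J-sign true  false true  = refl
  J-sign true  true  false = refl
  J-sign true  true  true  = refl

  monomial-sign : ∀ σ₁ σ₂ f₁ f₂ δ → (σ₁ xor (f₁ ∧ δ)) xor (σ₂ xor (f₂ ∧ (δ xor f₁)))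
                                    ≡ ((σ₁ xor σ₂) xor (f₁ ∧ f₂)) xor ((f₁ xor f₂) ∧ δ)
  monomial-sign σ₁ σ₂ f₁ f₂ δ = begin
    (σ₁ xor (f₁ ∧ δ)) xor (σ₂ xor (f₂ ∧ (δ xor f₁)))  ≡⟨ xor-interchange σ₁ (f₁ ∧ δ) σ₂ _ ⟩
    (σ₁ xor σ₂) xor ((f₁ ∧ δ) xor (f₂ ∧ (δ xor f₁)))  ≡⟨ cong ((σ₁ xor σ₂) xor_) (J-sign f₁ f₂ δ) ⟩
    (σ₁ xor σ₂) xor ((f₁ ∧ f₂) xor ((f₁ xor f₂) ∧ δ)) ≡⟨ xor-assoc (σ₁ xor σ₂) _ _ ⟨
    ((σ₁ xor σ₂) xor (f₁ ∧ f₂)) xor ((f₁ xor f₂) ∧ δ) ∎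
    where
    open ≡-Reasoning
    open import Algebra.Properties.CommutativeSemigroup (CommutativeRing.+-commutativeSemigroup xor-∧-commutativeRing)
      using () renaming (interchange to xor-interchange)

module Sums {c ℓ : Level} (R : CommutativeRing c ℓ) where
  open import Data.Nat using (ℕ; zero; suc; _<_; _≟_; s≤s)
  open import Data.Nat.Properties using (≤-refl; m≤n⇒m≤1+n; <-irrefl; ≤∧≢⇒<)
  open import Relation.Binary.PropositionalEquality using (_≡_; _≢_)
  import Relation.Binary.PropositionalEquality as ≡
  open import Relation.Nullary using (yes; no)
  open CommutativeRing R
  open OverRing R
  open import Relation.Binary.Reasoning.Setoid setoid

  Σ<-cong : ∀ n {f h : ℕ → Carrier} → (∀ i → i < n → f i ≈ h i) → Σ< n f ≈ Σ< n h
  Σ<-cong zero    f≈h = refl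
  Σ<-cong (suc n) f≈h = +-cong (Σ<-cong n (λ i i<n → f≈h i (m≤n⇒m≤1+n i<n))) (f≈h n ≤-refl)

  Σ<-≈0 : ∀ n (f : ℕ → Carrier) → (∀ i → i < n → f i ≈ 0#) → Σ< n f ≈ 0#
  Σ<-≈0 n f f≈0 = trans (Σ<-cong n f≈0) (Σ<0 n)
    where
    Σ<0 : ∀ n → Σ< n (λ _ → 0#) ≈ 0#
    Σ<0 zero    = refl
    Σ<0 (suc n) = trans (+-identityʳ _) (Σ<0 n)

  Σ<-head : ∀ n (f : ℕ → Carrier) → Σ< (suc n) f ≈ f 0 + Σ< n (λ i → f (suc i))
  Σ<-head zero    f = +-comm 0# (f 0)
  Σ<-head (suc n) f = trans (+-congʳ (Σ<-head n f)) (+-assoc _ _ _)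

  Σ<-distrib-+ : ∀ n (f h : ℕ → Carrier) → Σ< n (λ i → f i + h i) ≈ Σ< n f + Σ< n h
  Σ<-distrib-+ zero    f h = sym (+-identityˡ 0#)
  Σ<-distrib-+ (suc n) f h = begin
    Σ< n (λ i → f i + h i) + (f n + h n) ≈⟨ +-congʳ (Σ<-distrib-+ n f h) ⟩
    (Σ< n f + Σ< n h) + (f n + h n)       ≈⟨ +-interchange _ _ _ _ ⟩
    (Σ< n f + f n) + (Σ< n h + h n)       ∎
    where open import Algebra.Properties.CommutativeSemigroup +-commutativeSemigroup
            renaming (interchange to +-interchange)

  Σ<-single : ∀ n (f : ℕ → Carrier) k → k < n → (∀ i → i < n → i ≢ k → f i ≈ 0#) → Σ< n f ≈ f k
  Σ<-single (suc n) f k k<1+n f≈0 with k ≟ n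
  ... | yes ≡.refl = begin
    Σ< n f + f n ≈⟨ +-congʳ (Σ<-≈0 n f (λ i i<n → f≈0 i (m≤n⇒m≤1+n i<n) (λ { ≡.refl → <-irrefl ≡.refl i<n }))) ⟩
    0# + f n     ≈⟨ +-identityˡ _ ⟩
    f n          ∎
  ... | no k≢n = begin
    Σ< n f + f n ≈⟨ +-cong (Σ<-single n f k (k<n k<1+n k≢n) (λ i i<n → f≈0 i (m≤n⇒m≤1+n i<n)))
                           (f≈0 n ≤-refl (λ n≡k → k≢n (≡.sym n≡k))) ⟩
    f k + 0#     ≈⟨ +-identityʳ _ ⟩
    f k          ∎
    where
    k<n : ∀ {k n} → k < suc n → k ≢ n → k < n
    k<n (s≤s k≤n) k≢n = ≤∧≢⇒< k≤n k≢n

module Polynomials {c ℓ : Level} (R : CommutativeRing c ℓ) where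
  open import Data.Nat using (ℕ; zero; suc; _∸_; _<_)
  open import Data.Nat.Properties using (n∸n≡0; +-∸-assoc; m>n⇒m∸n≢0; ≤-pred)
  open import Data.Empty using (⊥-elim)
  import Relation.Binary.PropositionalEquality as ≡
  open CommutativeRing R
  open import Algebra.Properties.Ring ring using (-0#≈0#)
  open OverRing R
  open Sums R
  open import Relation.Binary.Reasoning.Setoid setoid

  0ₚ-coeff : ∀ k → 0ₚ k ≈ 0#
  0ₚ-coeff zero    = refl
  0ₚ-coeff (suc k) = refl

  Σₚ-coeff : ∀ n (F : ℕ → Poly) k → P.Σ< n F k ≈ Σ< n (λ i → F i k)
  Σₚ-coeff zero    F k = 0ₚ-coeff k
  Σₚ-coeff (suc n) F k = +-congʳ (Σₚ-coeff n F k)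

  *ₚ-cong : ∀ {f f′ h h′} → f ≈ₚ f′ → h ≈ₚ h′ → (f *ₚ h) ≈ₚ (f′ *ₚ h′)
  *ₚ-cong f≈f′ h≈h′ k = Σ<-cong (suc k) (λ i _ → *-cong (f≈f′ i) (h≈h′ (k ∸ i)))

  *ₚ-congʳ : ∀ {f f′} h → f ≈ₚ f′ → (f *ₚ h) ≈ₚ (f′ *ₚ h)
  *ₚ-congʳ h f≈f′ = *ₚ-cong {h = h} f≈f′ (λ _ → refl)

  *ₚ-congˡ : ∀ f {h h′} → h ≈ₚ h′ → (f *ₚ h) ≈ₚ (f *ₚ h′)
  *ₚ-congˡ f h≈h′ = *ₚ-cong {f = f} (λ _ → refl) h≈h′

  constₚ-*ₚ : ∀ a f k → (constₚ a *ₚ f) k ≈ a * f k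
  constₚ-*ₚ a f k = begin
    Σ< (suc k) (λ i → constₚ a i * f (k ∸ i))  ≈⟨ Σ<-head k _ ⟩
    a * f k + Σ< k (λ i → 0# * f (k ∸ suc i)) ≈⟨ +-congˡ (Σ<-≈0 k _ (λ i _ → zeroˡ _)) ⟩
    a * f k + 0#                              ≈⟨ +-identityʳ _ ⟩
    a * f k                                   ∎

  *ₚ-identityˡ : ∀ f → (1ₚ *ₚ f) ≈ₚ f
  *ₚ-identityˡ f k = trans (constₚ-*ₚ 1# f k) (*-identityˡ _)

  *ₚ-zeroˡ : ∀ {Z} f → Z ≈ₚ 0ₚ → (Z *ₚ f) ≈ₚ 0ₚ
  *ₚ-zeroˡ f Z≈0 k = begin
    (_ *ₚ f) k  ≈⟨ *ₚ-congʳ f Z≈0 k ⟩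
    (0ₚ *ₚ f) k ≈⟨ constₚ-*ₚ 0# f k ⟩
    0# * f k    ≈⟨ zeroˡ _ ⟩
    0#          ≈⟨ 0ₚ-coeff k ⟨
    0ₚ k        ∎

  *ₚ-identityʳ : ∀ f → (f *ₚ 1ₚ) ≈ₚ f
  *ₚ-identityʳ f k = begin
    Σ< k (λ i → f i * 1ₚ (k ∸ i)) + f k * 1ₚ (k ∸ k)
      ≈⟨ +-cong (Σ<-≈0 k _ off-diagonal) (*-congˡ (reflexive (≡.cong 1ₚ (n∸n≡0 k)))) ⟩
    0# + f k * 1# ≈⟨ +-identityˡ _ ⟩
    f k * 1#      ≈⟨ *-identityʳ _ ⟩
    f k           ∎
    where
    off-diagonal : ∀ i → i < k → f i * 1ₚ (k ∸ i) ≈ 0#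
    off-diagonal i i<k with k ∸ i | m>n⇒m∸n≢0 i<k
    ... | zero  | k∸i≢0 = ⊥-elim (k∸i≢0 ≡.refl)
    ... | suc _ | _     = zeroʳ _

  shiftₚ : Poly → Poly
  shiftₚ f zero    = 0#
  shiftₚ f (suc k) = f k

  shiftₚ-cong : ∀ {f h} → f ≈ₚ h → shiftₚ f ≈ₚ shiftₚ h
  shiftₚ-cong f≈h zero    = refl
  shiftₚ-cong f≈h (suc k) = f≈h k

  Tₚ≈shiftₚ1ₚ : Tₚ ≈ₚ shiftₚ 1ₚ
  Tₚ≈shiftₚ1ₚ zero          = refl
  Tₚ≈shiftₚ1ₚ (suc zero)    = refl
  Tₚ≈shiftₚ1ₚ (suc (suc k)) = refl

  shiftₚ-*ₚ : ∀ f h → (shiftₚ f *ₚ h) ≈ₚ shiftₚ (f *ₚ h)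
  shiftₚ-*ₚ f h zero    = trans (+-identityˡ _) (zeroˡ _)
  shiftₚ-*ₚ f h (suc k) = begin
    Σ< (suc (suc k)) (λ i → shiftₚ f i * h (suc k ∸ i))    ≈⟨ Σ<-head (suc k) _ ⟩
    0# * h (suc k) + Σ< (suc k) (λ i → f i * h (k ∸ i))   ≈⟨ +-congʳ (zeroˡ _) ⟩
    0# + Σ< (suc k) (λ i → f i * h (k ∸ i))               ≈⟨ +-identityˡ _ ⟩
    (f *ₚ h) k                                            ∎

  *ₚ-shiftₚ : ∀ f h → (f *ₚ shiftₚ h) ≈ₚ shiftₚ (f *ₚ h)
  *ₚ-shiftₚ f h zero    = trans (+-identityˡ _) (zeroʳ _)
  *ₚ-shiftₚ f h (suc k) = begin
    Σ< (suc k) (λ i → f i * shiftₚ h (suc k ∸ i)) + f (suc k) * shiftₚ h (suc k ∸ suc k)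
      ≈⟨ +-cong (Σ<-cong (suc k) (λ i i<1+k → *-congˡ (reflexive (≡.cong (shiftₚ h) (+-∸-assoc 1 (≤-pred i<1+k))))))
                (*-congˡ (reflexive (≡.cong (shiftₚ h) (n∸n≡0 k)))) ⟩
    Σ< (suc k) (λ i → f i * h (k ∸ i)) + f (suc k) * 0# ≈⟨ +-congˡ (zeroʳ _) ⟩
    (f *ₚ h) k + 0#                                     ≈⟨ +-identityʳ _ ⟩
    (f *ₚ h) k                                          ∎

  Tₚ-*ₚ : ∀ f → (Tₚ *ₚ f) ≈ₚ shiftₚ f
  Tₚ-*ₚ f k = begin
    (Tₚ *ₚ f) k        ≈⟨ *ₚ-congʳ f Tₚ≈shiftₚ1ₚ k ⟩
    (shiftₚ 1ₚ *ₚ f) k ≈⟨ shiftₚ-*ₚ 1ₚ f k ⟩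
    shiftₚ (1ₚ *ₚ f) k ≈⟨ shiftₚ-cong (*ₚ-identityˡ f) k ⟩
    shiftₚ f k         ∎

  *ₚ-distribˡ-+ₚ : ∀ f g h → (f *ₚ (g +ₚ h)) ≈ₚ ((f *ₚ g) +ₚ (f *ₚ h))
  *ₚ-distribˡ-+ₚ f g h k =
    trans (Σ<-cong (suc k) (λ i _ → distribˡ _ _ _)) (Σ<-distrib-+ (suc k) _ _)

  Tₚ²≈shiftₚ²1ₚ : (Tₚ ^ₚ 2) ≈ₚ shiftₚ (shiftₚ 1ₚ)
  Tₚ²≈shiftₚ²1ₚ k = begin
    ((1ₚ *ₚ Tₚ) *ₚ Tₚ) k ≈⟨ *ₚ-congʳ Tₚ (*ₚ-identityˡ Tₚ) k ⟩
    (Tₚ *ₚ Tₚ) k         ≈⟨ Tₚ-*ₚ Tₚ k ⟩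
    shiftₚ Tₚ k          ≈⟨ shiftₚ-cong Tₚ≈shiftₚ1ₚ k ⟩
    shiftₚ (shiftₚ 1ₚ) k ∎

  *ₚ-T²+1 : ∀ f → (f *ₚ ((Tₚ ^ₚ 2) +ₚ 1ₚ)) ≈ₚ (f +ₚ shiftₚ (shiftₚ f))
  *ₚ-T²+1 f k = begin
    (f *ₚ ((Tₚ ^ₚ 2) +ₚ 1ₚ)) k                ≈⟨ *ₚ-distribˡ-+ₚ f (Tₚ ^ₚ 2) 1ₚ k ⟩
    (f *ₚ (Tₚ ^ₚ 2)) k + (f *ₚ 1ₚ) k          ≈⟨ +-comm _ _ ⟩
    (f *ₚ 1ₚ) k + (f *ₚ (Tₚ ^ₚ 2)) k          ≈⟨ +-cong (*ₚ-identityʳ f k) (*ₚ-congˡ f Tₚ²≈shiftₚ²1ₚ k) ⟩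
    f k + (f *ₚ shiftₚ (shiftₚ 1ₚ)) k         ≈⟨ +-congˡ (*ₚ-shiftₚ f _ k) ⟩
    f k + shiftₚ (f *ₚ shiftₚ 1ₚ) k           ≈⟨ +-congˡ (shiftₚ-cong (*ₚ-shiftₚ f 1ₚ) k) ⟩
    f k + shiftₚ (shiftₚ (f *ₚ 1ₚ)) k         ≈⟨ +-congˡ (shiftₚ-cong (shiftₚ-cong (*ₚ-identityʳ f)) k) ⟩
    f k + shiftₚ (shiftₚ f) k                 ∎

  P-sgn-0ₚ : ∀ l {Y} → Y ≈ₚ 0ₚ → P.sgn l Y ≈ₚ 0ₚ
  P-sgn-0ₚ zero          Y≈0 = Y≈0
  P-sgn-0ₚ (suc zero)    Y≈0 k = trans (-‿cong (trans (Y≈0 k) (0ₚ-coeff k))) (trans -0#≈0# (sym (0ₚ-coeff k)))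
  P-sgn-0ₚ (suc (suc l)) Y≈0 = P-sgn-0ₚ l Y≈0

  Σₚ-head : ∀ N (G : ℕ → Poly) → (∀ l → l < N → G (suc l) ≈ₚ 0ₚ) → P.Σ< (suc N) G ≈ₚ G 0
  Σₚ-head N G tail≈0 k = begin
    P.Σ< (suc N) G k                   ≈⟨ Σₚ-coeff (suc N) G k ⟩
    Σ< (suc N) (λ l → G l k)           ≈⟨ Σ<-head N _ ⟩
    G 0 k + Σ< N (λ l → G (suc l) k)   ≈⟨ +-congˡ (Σ<-≈0 N _ (λ l l<N → trans (tail≈0 l l<N k) (0ₚ-coeff k))) ⟩
    G 0 k + 0#                         ≈⟨ +-identityʳ _ ⟩
    G 0 k                              ∎

  Σₚ-head₂ : ∀ N (G : ℕ → Poly) → (∀ l → l < N → G (suc (suc l)) ≈ₚ 0ₚ) → P.Σ< (suc (suc N)) G ≈ₚ (G 0 +ₚ G 1)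
  Σₚ-head₂ N G tail≈0 k = begin
    P.Σ< (suc (suc N)) G k                 ≈⟨ Σₚ-coeff (suc (suc N)) G k ⟩
    Σ< (suc (suc N)) (λ l → G l k)         ≈⟨ Σ<-head (suc N) _ ⟩
    G 0 k + Σ< (suc N) (λ l → G (suc l) k) ≈⟨ +-congˡ (Σₚ-coeff (suc N) _ k) ⟨
    G 0 k + P.Σ< (suc N) (λ l → G (suc l)) k ≈⟨ +-congˡ (Σₚ-head N (λ l → G (suc l)) tail≈0 k) ⟩
    G 0 k + G 1 k                          ∎

module BlockDiagonalDeterminant {c ℓ : Level} (R : CommutativeRing c ℓ) where
  open BlockIndexing
  open import Data.Bool using (Bool; true; false; not; if_then_else_)
  open import Data.Nat as ℕ using (ℕ; zero; suc; _≡ᵇ_; _<_; z≤n; s≤s)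
  import Data.Nat.Properties as ℕ
  import Relation.Binary.PropositionalEquality as ≡
  open CommutativeRing R
  open OverRing R
  open Polynomials R
  open import Algebra.Properties.Ring ring using (-1*x≈-x; -‿involutive)
  open import Relation.Binary.Reasoning.Setoid setoid

  det-firstRow-single : ∀ N (M : ℕ → ℕ → Poly) → (∀ l → l < N → M 0 (suc l) ≈ₚ 0ₚ) →
                        P.det (suc N) M ≈ₚ (M 0 0 *ₚ P.det N (P.minor 0 M))
  det-firstRow-single N M row₀≈0 =
    Σₚ-head N _ (λ l l<N → P-sgn-0ₚ (suc l) (*ₚ-zeroˡ (P.det N (P.minor (suc l) M)) (row₀≈0 l l<N)))

  det-firstRow-pair : ∀ N (M : ℕ → ℕ → Poly) → (∀ l → l < N → M 0 (suc (suc l)) ≈ₚ 0ₚ) →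
                      P.det (suc (suc N)) M
                        ≈ₚ ((M 0 0 *ₚ P.det (suc N) (P.minor 0 M)) +ₚ (-ₚ (M 0 1 *ₚ P.det (suc N) (P.minor 1 M))))
  det-firstRow-pair N M row₀≈0 =
    Σₚ-head₂ N _ (λ l l<N → P-sgn-0ₚ l (*ₚ-zeroˡ (P.det (suc N) (P.minor (suc (suc l)) M)) (row₀≈0 l l<N)))

  charBlockRow : ℕ → Bool → Carrier → ℕ → Poly
  charBlockRow i δ a s =
    if s ≡ᵇ blockRow i δ then Tₚ else (if s ≡ᵇ blockRow i (not δ) then constₚ a else 0ₚ)

  record DiagonalBlock (M : ℕ → ℕ → Poly) (i : ℕ) : Set (c ⊔ ℓ) where
    field
      a b   : Carrier
      ab≈-1 : a * b ≈ - 1#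
      row₀  : ∀ s → M (blockRow i false) s ≈ₚ charBlockRow i false a s
      row₁  : ∀ s → M (blockRow i true) s ≈ₚ charBlockRow i true b s

  BlockDiagonal : ℕ → (ℕ → ℕ → Poly) → Set (c ⊔ ℓ)
  BlockDiagonal k M = ∀ i → i < k → DiagonalBlock M i

  dropBlock : (ℕ → ℕ → Poly) → (ℕ → ℕ → Poly)
  dropBlock M r s = M (suc (suc r)) (suc (suc s))

  dropBlock-blockDiagonal : ∀ k M → BlockDiagonal (suc k) M → BlockDiagonal k (dropBlock M)
  dropBlock-blockDiagonal k M bd i i<k = record
    { a = a ; b = b ; ab≈-1 = ab≈-1
    ; row₀ = λ s → row₀ (suc (suc s)) ; row₁ = λ s → row₁ (suc (suc s)) }
    where open DiagonalBlock (bd (suc i) (s≤s i<k))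

  det-blockDiagonal-step : ∀ k M → DiagonalBlock M 0 →
                           P.det (2 ℕ.* k) (dropBlock M) ≈ₚ (((Tₚ ^ₚ 2) +ₚ 1ₚ) ^ₚ k) →
                           P.det (suc (suc (2 ℕ.* k))) M ≈ₚ (((Tₚ ^ₚ 2) +ₚ 1ₚ) ^ₚ suc k)
  det-blockDiagonal-step k M blk det-rest x = begin
    P.det (suc (suc N)) M x                                     ≈⟨ det-firstRow-pair N M (λ l _ → row₀ (suc (suc l))) x ⟩
    (M 0 0 *ₚ P.det (suc N) (P.minor 0 M)) x
      + - (M 0 1 *ₚ P.det (suc N) (P.minor 1 M)) x              ≈⟨ +-cong diagonal-term (-‿cong antidiagonal-term) ⟩
    shiftₚ (shiftₚ Xᵏ) x + - (a * (b * Xᵏ x))                   ≈⟨ +-congˡ -ab≈1 ⟩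
    shiftₚ (shiftₚ Xᵏ) x + Xᵏ x                                 ≈⟨ +-comm _ _ ⟩
    Xᵏ x + shiftₚ (shiftₚ Xᵏ) x                                 ≈⟨ *ₚ-T²+1 Xᵏ x ⟨
    (Xᵏ *ₚ ((Tₚ ^ₚ 2) +ₚ 1ₚ)) x                                 ∎
    where
    open DiagonalBlock blk
    N  = 2 ℕ.* k
    Xᵏ = ((Tₚ ^ₚ 2) +ₚ 1ₚ) ^ₚ k
    minor₀ : P.det (suc N) (P.minor 0 M) ≈ₚ (Tₚ *ₚ Xᵏ)
    minor₀ y = trans (det-firstRow-single N (P.minor 0 M) (λ l _ → row₁ (suc (suc l))) y)
                     (*ₚ-cong (row₁ 1) det-rest y)
    minor₁ : P.det (suc N) (P.minor 1 M) ≈ₚ (constₚ b *ₚ Xᵏ)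
    minor₁ y = trans (det-firstRow-single N (P.minor 1 M) (λ l _ → row₁ (suc (suc l))) y)
                     (*ₚ-cong (row₁ 0) det-rest y)
    diagonal-term : (M 0 0 *ₚ P.det (suc N) (P.minor 0 M)) x ≈ shiftₚ (shiftₚ Xᵏ) x
    diagonal-term = begin
      (M 0 0 *ₚ P.det (suc N) (P.minor 0 M)) x ≈⟨ *ₚ-cong (row₀ 0) minor₀ x ⟩
      (Tₚ *ₚ (Tₚ *ₚ Xᵏ)) x                     ≈⟨ Tₚ-*ₚ (Tₚ *ₚ Xᵏ) x ⟩
      shiftₚ (Tₚ *ₚ Xᵏ) x                      ≈⟨ shiftₚ-cong (Tₚ-*ₚ Xᵏ) x ⟩
      shiftₚ (shiftₚ Xᵏ) x                     ∎
    antidiagonal-term : (M 0 1 *ₚ P.det (suc N) (P.minor 1 M)) x ≈ a * (b * Xᵏ x)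
    antidiagonal-term = begin
      (M 0 1 *ₚ P.det (suc N) (P.minor 1 M)) x ≈⟨ *ₚ-cong (row₀ 1) minor₁ x ⟩
      (constₚ a *ₚ (constₚ b *ₚ Xᵏ)) x         ≈⟨ constₚ-*ₚ a (constₚ b *ₚ Xᵏ) x ⟩
      a * (constₚ b *ₚ Xᵏ) x                   ≈⟨ *-congˡ (constₚ-*ₚ b Xᵏ x) ⟩
      a * (b * Xᵏ x)                           ∎
    -ab≈1 : - (a * (b * Xᵏ x)) ≈ Xᵏ x
    -ab≈1 = begin
      - (a * (b * Xᵏ x)) ≈⟨ -‿cong (sym (*-assoc a b _)) ⟩
      - ((a * b) * Xᵏ x) ≈⟨ -‿cong (*-congʳ ab≈-1) ⟩
      - (- 1# * Xᵏ x)    ≈⟨ -‿cong (-1*x≈-x _) ⟩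
      - (- Xᵏ x)         ≈⟨ -‿involutive _ ⟩
      Xᵏ x               ∎

  det-blockDiagonal : ∀ k M → BlockDiagonal k M → P.det (2 ℕ.* k) M ≈ₚ (((Tₚ ^ₚ 2) +ₚ 1ₚ) ^ₚ k)
  det-blockDiagonal zero    M bd x = refl
  det-blockDiagonal (suc k) M bd =
    ≡.subst (λ n → P.det n M ≈ₚ (((Tₚ ^ₚ 2) +ₚ 1ₚ) ^ₚ suc k)) (≡.sym 2[1+k]≡2+2k)
      (det-blockDiagonal-step k M (bd 0 (s≤s z≤n))
        (det-blockDiagonal k (dropBlock M) (dropBlock-blockDiagonal k M bd)))
    where
    2[1+k]≡2+2k : 2 ℕ.* suc k ≡.≡ suc (suc (2 ℕ.* k))
    2[1+k]≡2+2k = ℕ.*-suc 2 k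

module MonomialRows {c ℓ : Level} (R : CommutativeRing c ℓ) where
  open Arithmetic using (≡ᵇ-refl; ≡ᵇ-≢; ≡ᵇ-sym)
  open BlockIndexing
  open BooleanSigns
  open import Data.Bool using (Bool; true; false; not; if_then_else_; _∧_; _xor_)
  open import Data.Bool.Properties using (xor-assoc; xor-same; xor-identityʳ)
  open import Data.Nat using (ℕ; zero; suc; _≡ᵇ_; _<_)
  open import Data.Nat.GeneralisedArithmetic using (fold)
  open import Data.Product using (∃-syntax; _,_)
  import Relation.Binary.PropositionalEquality as ≡
  open CommutativeRing R
  open OverRing R
  open Sums R
  open import Algebra.Properties.Ring ring using (-1*x≈-x; -‿involutive)
  open import Relation.Binary.Reasoning.Setoid setoid

  MonomialRow : Mat → ℕ → ℕ → Carrier → Set ℓ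
  MonomialRow A r k α = ∀ s → A r s ≈ (if s ≡ᵇ k then α else 0#)

  monomialRow-resp : ∀ A r {k k′ α α′} → k ≡.≡ k′ → α ≈ α′ → MonomialRow A r k α → MonomialRow A r k′ α′
  monomialRow-resp A r {k = k} {α = α} ≡.refl α≈α′ row s with s ≡ᵇ k | row s
  ... | true  | Ars≈α = trans Ars≈α α≈α′
  ... | false | Ars≈0 = Ars≈0

  mul-monomialRow : ∀ N A B {r k k′ α β} → k < N → MonomialRow A r k α → MonomialRow B k k′ β →
                    MonomialRow (mul N A B) r k′ (α * β)
  mul-monomialRow N A B {r} {k} {k′} {α} {β} k<N rowA rowB s = begin
    Σ< N (λ t → A r t * B t s)               ≈⟨ Σ<-single N _ k k<N off-k ⟩
    A r k * B k s                            ≈⟨ *-cong (trans (rowA k) (reflexive (≡.cong (if_then α else 0#) (≡ᵇ-refl k)))) (rowB s) ⟩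
    α * (if s ≡ᵇ k′ then β else 0#)          ≈⟨ *-if (s ≡ᵇ k′) ⟩
    (if s ≡ᵇ k′ then α * β else 0#)          ∎
    where
    off-k : ∀ t → t < N → t ≡.≢ k → A r t * B t s ≈ 0#
    off-k t _ t≢k = trans (*-congʳ (trans (rowA t) (reflexive (≡.cong (if_then α else 0#) (≡ᵇ-≢ t k t≢k))))) (zeroˡ _)
    *-if : ∀ b → α * (if b then β else 0#) ≈ (if b then α * β else 0#)
    *-if true  = refl
    *-if false = zeroʳ α

  sign : Bool → Carrier
  sign b = if b then - 1# else 1#

  sign-xor : ∀ a b → sign a * sign b ≈ sign (a xor b)
  sign-xor false b     = *-identityˡ _
  sign-xor true  false = *-identityʳ _
  sign-xor true  true  = trans (-1*x≈-x (- 1#)) (-‿involutive 1#)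

  -- Block row i of A is (-1)^σ J^f in block column j and zero elsewhere, where J = [[0,1],[-1,0]].
  record MonomialBlockRow (A : Mat) (i j : ℕ) (f σ : Bool) : Set ℓ where
    constructor monomialBlockRow
    field row : ∀ δ → MonomialRow A (blockRow i δ) (blockRow j (δ xor f)) (sign (σ xor (f ∧ δ)))
  open MonomialBlockRow public

  mul-monomialBlockRow : ∀ N A B {i j k f₁ f₂ σ₁ σ₂} → (∀ δ → blockRow j δ < N) →
                         MonomialBlockRow A i j f₁ σ₁ → MonomialBlockRow B j k f₂ σ₂ →
                         MonomialBlockRow (mul N A B) i k (f₁ xor f₂) ((σ₁ xor σ₂) xor (f₁ ∧ f₂))
  mul-monomialBlockRow N A B {i} {k = k} {f₁} {f₂} {σ₁} {σ₂} j<N rowA rowB = monomialBlockRow λ δ →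
    monomialRow-resp (mul N A B) (blockRow i δ) (≡.cong (blockRow k) (xor-assoc δ f₁ f₂))
      (trans (sign-xor _ _) (reflexive (≡.cong sign (monomial-sign σ₁ σ₂ f₁ f₂ δ))))
      (mul-monomialRow N A B (j<N (δ xor f₁)) (row rowA δ) (row rowB (δ xor f₁)))

  idM-monomialBlockRow : ∀ i → MonomialBlockRow idM i i false false
  idM-monomialBlockRow i = monomialBlockRow λ δ s → idM-row δ s
    where
    idM-row : ∀ δ s → idM (blockRow i δ) s ≈ (if s ≡ᵇ blockRow i (δ xor false) then sign (false xor (false ∧ δ)) else 0#)
    idM-row δ s rewrite xor-identityʳ δ | ≡ᵇ-sym (blockRow i δ) s = refl

  diagonal-product-antidiagonal :
    ∀ N D A B {i j f₁ f₂ σ₁ σ₂} (w : Bool → Carrier) →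
    (∀ δ → blockRow i δ < N) → (∀ δ → blockRow j δ < N) →
    (∀ δ → MonomialRow D (blockRow i δ) (blockRow i δ) (w δ)) →
    MonomialBlockRow A i j f₁ σ₁ → MonomialBlockRow B j i f₂ σ₂ → f₁ xor f₂ ≡.≡ true →
    ∀ δ → MonomialRow (mul N (mul N D A) B) (blockRow i δ) (blockRow i (not δ))
                      (w δ * sign (((σ₁ xor σ₂) xor (f₁ ∧ f₂)) xor δ))
  diagonal-product-antidiagonal N D A B {i} {j} {f₁} {f₂} {σ₁} {σ₂} w i<N j<N rowD rowA rowB f₁⊕f₂ δ =
    monomialRow-resp (mul N (mul N D A) B) (blockRow i δ) (≡.cong (blockRow i) column) value
      (mul-monomialRow N (mul N D A) B (j<N (δ xor f₁))
        (mul-monomialRow N D A (i<N δ) (rowD δ) (row rowA δ))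
        (row rowB (δ xor f₁)))
    where
    column : (δ xor f₁) xor f₂ ≡.≡ not δ
    column = ≡.trans (xor-assoc δ f₁ f₂) (≡.trans (≡.cong (δ xor_) f₁⊕f₂) (xor-true δ))
      where xor-true : ∀ b → b xor true ≡.≡ not b
            xor-true false = ≡.refl
            xor-true true  = ≡.refl
    value : (w δ * sign (σ₁ xor (f₁ ∧ δ))) * sign (σ₂ xor (f₂ ∧ (δ xor f₁)))
              ≈ w δ * sign (((σ₁ xor σ₂) xor (f₁ ∧ f₂)) xor δ)
    value = begin
      (w δ * sign (σ₁ xor (f₁ ∧ δ))) * sign (σ₂ xor (f₂ ∧ (δ xor f₁)))   ≈⟨ *-assoc _ _ _ ⟩
      w δ * (sign (σ₁ xor (f₁ ∧ δ)) * sign (σ₂ xor (f₂ ∧ (δ xor f₁))))   ≈⟨ *-congˡ (sign-xor _ _) ⟩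
      w δ * sign ((σ₁ xor (f₁ ∧ δ)) xor (σ₂ xor (f₂ ∧ (δ xor f₁))))      ≡⟨ ≡.cong (λ b → w δ * sign b) (monomial-sign σ₁ σ₂ f₁ f₂ δ) ⟩
      w δ * sign (((σ₁ xor σ₂) xor (f₁ ∧ f₂)) xor ((f₁ xor f₂) ∧ δ))     ≡⟨ ≡.cong (λ b → w δ * sign (((σ₁ xor σ₂) xor (f₁ ∧ f₂)) xor (b ∧ δ))) f₁⊕f₂ ⟩
      w δ * sign (((σ₁ xor σ₂) xor (f₁ ∧ f₂)) xor δ)                     ∎

  module Orbit (N : ℕ) (A : Mat) {Pt : Set} (Valid : Pt → Set)
               (index : Pt → ℕ) (orient : Pt → Bool) (φ : Pt → Pt)
               (index<N : ∀ {P} → Valid P → ∀ δ → blockRow (index P) δ < N)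
               (φ-valid : ∀ {P} → Valid P → Valid (φ P))
               (step : ∀ {P} → Valid P →
                       MonomialBlockRow A (index P) (index (φ P)) (orient P xor orient (φ P)) false)
               where

    fold-valid : ∀ {P} → Valid P → ∀ t → Valid (fold P φ t)
    fold-valid valid zero    = valid
    fold-valid valid (suc t) = φ-valid (fold-valid valid t)

    pow-monomialBlockRow : ∀ {P} → Valid P → ∀ t →
      ∃[ σ ] MonomialBlockRow (pow N A t) (index P) (index (fold P φ t)) (orient P xor orient (fold P φ t)) σ
    pow-monomialBlockRow {P} valid zero =
      false , ≡.subst (λ f → MonomialBlockRow idM (index P) (index P) f false)
                      (≡.sym (xor-same (orient P))) (idM-monomialBlockRow (index P))
    pow-monomialBlockRow {P} valid (suc t) with pow-monomialBlockRow valid t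
    ... | σ , row = σ′ , ≡.subst (λ f → MonomialBlockRow (pow N A (suc t)) (index P) (index Pₜ₊₁) f σ′)
                                (xor-telescope (orient P) (orient Pₜ) (orient Pₜ₊₁))
                                (mul-monomialBlockRow N (pow N A t) A (index<N (fold-valid valid t)) row (step (fold-valid valid t)))
      where
      Pₜ   = fold P φ t
      Pₜ₊₁ = φ Pₜ
      σ′   = (σ xor false) xor ((orient P xor orient Pₜ) ∧ (orient Pₜ xor orient Pₜ₊₁))

module AntidiagonalCharPoly {c ℓ : Level} (R : CommutativeRing c ℓ) where
  open Arithmetic using (≡ᵇ-refl; ≡ᵇ-≢; ≡ᵇ-sym; ≡ᵇ-true⇒≡)
  open BlockIndexing
  open import Data.Bool using (true; false; not; if_then_else_; _xor_)
  open import Data.Nat as ℕ using (ℕ; zero; suc; _≡ᵇ_; _<_)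
  import Relation.Binary.PropositionalEquality as ≡
  open CommutativeRing R
  open OverRing R
  open MonomialRows R
  open BlockDiagonalDeterminant R
  open import Algebra.Properties.Ring ring using (-0#≈0#; -‿distribˡ-*; -‿distribʳ-*; -‿involutive)

  record AntidiagonalBlock (M : Mat) (i : ℕ) : Set (c ⊔ ℓ) where
    field
      α β   : Carrier
      αβ≈-1 : α * β ≈ - 1#
      row₀  : MonomialRow M (blockRow i false) (blockRow i true) α
      row₁  : MonomialRow M (blockRow i true) (blockRow i false) β

  charMat : Mat → ℕ → ℕ → Poly
  charMat M i j = (if i ≡ᵇ j then Tₚ else 0ₚ) +ₚ (-ₚ constₚ (M i j))

  charMat-monomialRow : ∀ M i δ {α} → MonomialRow M (blockRow i δ) (blockRow i (not δ)) α →
                        ∀ s → charMat M (blockRow i δ) s ≈ₚ charBlockRow i δ (- α) s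
  charMat-monomialRow M i δ {α} row s with s ≡ᵇ blockRow i δ in s≡row
  ... | true with ≡ᵇ-true⇒≡ s (blockRow i δ) s≡row
  ...   | ≡.refl rewrite ≡ᵇ-refl (blockRow i δ) = diagonal
    where
    Mii≈0 : M (blockRow i δ) (blockRow i δ) ≈ 0#
    Mii≈0 = trans (row _) (reflexive (≡.cong (if_then α else 0#) (≡ᵇ-≢ _ _ (blockRow-≢-not i δ))))
    diagonal : (Tₚ +ₚ (-ₚ constₚ (M (blockRow i δ) (blockRow i δ)))) ≈ₚ Tₚ
    diagonal zero    = trans (+-congˡ (trans (-‿cong Mii≈0) -0#≈0#)) (+-identityʳ _)
    diagonal (suc k) = trans (+-congˡ -0#≈0#) (+-identityʳ _)
  charMat-monomialRow M i δ {α} row s | false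
    rewrite ≡ᵇ-sym (blockRow i δ) s | s≡row with s ≡ᵇ blockRow i (not δ) | row s
  ... | true  | Mrs≈α = λ { zero → trans (+-identityˡ _) (-‿cong Mrs≈α) ; (suc k) → trans (+-congˡ -0#≈0#) (+-identityʳ _) }
  ... | false | Mrs≈0 = λ { zero → trans (+-identityˡ _) (trans (-‿cong Mrs≈0) -0#≈0#) ; (suc k) → trans (+-congˡ -0#≈0#) (+-identityʳ _) }

  charMat-diagonalBlock : ∀ M i → AntidiagonalBlock M i → DiagonalBlock (charMat M) i
  charMat-diagonalBlock M i blk = record
    { a = - α ; b = - β
    ; ab≈-1 = trans -α*-β≈αβ αβ≈-1
    ; row₀ = charMat-monomialRow M i false row₀
    ; row₁ = charMat-monomialRow M i true row₁ }
    where
    open AntidiagonalBlock blk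
    -α*-β≈αβ : (- α) * (- β) ≈ α * β
    -α*-β≈αβ = trans (sym (-‿distribˡ-* α (- β))) (trans (-‿cong (sym (-‿distribʳ-* α β))) (-‿involutive _))

  antidiagonalBlock : ∀ {M i} u v σ → u * v ≈ 1# →
    (∀ δ → MonomialRow M (blockRow i δ) (blockRow i (not δ)) ((if δ then v else u) * sign (σ xor δ))) →
    AntidiagonalBlock M i
  antidiagonalBlock u v σ uv≈1 rows = record
    { α = u * sign (σ xor false) ; β = v * sign (σ xor true)
    ; αβ≈-1 = begin
        (u * sign (σ xor false)) * (v * sign (σ xor true)) ≈⟨ *-interchange _ _ _ _ ⟩
        (u * v) * (sign (σ xor false) * sign (σ xor true)) ≈⟨ *-cong uv≈1 (sign-antipodal σ) ⟩
        1# * - 1#                                          ≈⟨ *-identityˡ _ ⟩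
        - 1#                                               ∎
    ; row₀ = rows false ; row₁ = rows true }
    where
    open import Relation.Binary.Reasoning.Setoid setoid
    open import Algebra.Properties.CommutativeSemigroup *-commutativeSemigroup
      using () renaming (interchange to *-interchange)
    sign-antipodal : ∀ σ → sign (σ xor false) * sign (σ xor true) ≈ - 1#
    sign-antipodal false = *-identityˡ _
    sign-antipodal true  = *-identityʳ _

  charPoly-antidiagonal : ∀ g M → (∀ i → i < g → AntidiagonalBlock M i) →
                          charPoly (2 ℕ.* g) M ≈ₚ (((Tₚ ^ₚ 2) +ₚ 1ₚ) ^ₚ g)
  charPoly-antidiagonal g M blocks =
    det-blockDiagonal g (charMat M) (λ i i<g → charMat-diagonalBlock M i (blocks i i<g))

module PrimeResidues (P₁ : ℕ) (P-prime : Prime (suc P₁)) where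
  open import Data.Nat
  open import Data.Nat.Properties
  open import Data.Nat.DivMod
  open import Data.Nat.Divisibility
  open import Data.Nat.Primality
  open import Data.Nat.GeneralisedArithmetic using (fold)
  open import Data.Fin as Fin using (Fin; toℕ; fromℕ<)
  import Data.Fin.Properties as Fin
  open import Data.Product using (_×_; _,_; proj₁; proj₂; ∃-syntax)
  open import Data.Sum using (_⊎_; inj₁; inj₂)
  open import Data.Empty using (⊥-elim)
  open import Function.Definitions using (Injective)
  open import Relation.Binary.PropositionalEquality
  open import Relation.Nullary using (¬_)

  P : ℕ
  P = suc P₁

  1<P : 1 < P
  1<P = nonTrivial⇒n>1 P {{prime⇒nonTrivial P-prime}}

  %≢0⇒∤ : ∀ x → x % P ≢ 0 → ¬ P ∣ x
  %≢0⇒∤ x x%P≢0 P∣x = x%P≢0 (n∣m⇒m%n≡0 x P P∣x)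

  *-%≢0 : ∀ x y → x % P ≢ 0 → y % P ≢ 0 → (x * y) % P ≢ 0
  *-%≢0 x y x≢0 y≢0 xy≡0 with euclidsLemma x y P-prime (m%n≡0⇒n∣m (x * y) P xy≡0)
  ... | inj₁ P∣x = %≢0⇒∤ x x≢0 P∣x
  ... | inj₂ P∣y = %≢0⇒∤ y y≢0 P∣y

  unit-%≢0 : ∀ {x} → 1 ≤ x → x < P → x % P ≢ 0
  unit-%≢0 {x} 1≤x x<P x%P≡0 = <⇒≱ 1≤x (≤-reflexive (trans (sym (m<n⇒m%n≡m x<P)) x%P≡0))

  ^-%≢0 : ∀ x → x % P ≢ 0 → ∀ k → (x ^ k) % P ≢ 0
  ^-%≢0 x x≢0 zero    = unit-%≢0 (s≤s z≤n) 1<P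
  ^-%≢0 x x≢0 (suc k) = *-%≢0 x (x ^ k) x≢0 (^-%≢0 x x≢0 k)

  %≢0⇒1≤% : ∀ x → x % P ≢ 0 → 1 ≤ x % P
  %≢0⇒1≤% x x≢0 with x % P
  ... | zero  = ⊥-elim (x≢0 refl)
  ... | suc _ = s≤s z≤n

  %≢0⇒1≤ : ∀ x → x % P ≢ 0 → 1 ≤ x
  %≢0⇒1≤ zero    x≢0 = ⊥-elim (x≢0 refl)
  %≢0⇒1≤ (suc x) x≢0 = s≤s z≤n

  *-%-congʳ : ∀ c a → (c * (a % P)) % P ≡ (c * a) % P
  *-%-congʳ c a = begin
    (c * (a % P)) % P             ≡⟨ %-distribˡ-* c (a % P) P ⟩
    ((c % P) * (a % P % P)) % P   ≡⟨ cong (λ z → ((c % P) * z) % P) (m%n%n≡m%n a P) ⟩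
    ((c % P) * (a % P)) % P       ≡⟨ %-distribˡ-* c a P ⟨
    (c * a) % P                   ∎
    where open ≡-Reasoning

  +-%≡0⇒≡∸ : ∀ {a b} → a < P → b < P → 1 ≤ b → (a + b) % P ≡ 0 → a ≡ P ∸ b
  +-%≡0⇒≡∸ {a} {b} a<P b<P 1≤b a+b≡0 with m%n≡0⇒n∣m (a + b) P a+b≡0
  ... | divides zero          a+b≡0*P = ⊥-elim (<⇒≱ (≤-trans 1≤b (m≤n+m b a)) (≤-reflexive a+b≡0*P))
  ... | divides (suc zero)    a+b≡P   = trans (sym (m+n∸n≡m a b)) (cong (_∸ b) (trans a+b≡P (+-identityʳ P)))
  ... | divides (suc (suc k)) a+b≡kP  =
    ⊥-elim (<⇒≱ (+-mono-< a<P b<P) (≤-trans (m≤m+n (P + P) (k * P)) (≤-reflexive (trans (+-assoc P P (k * P)) (sym a+b≡kP)))))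

  %-negation : ∀ A B → (A + B) % P ≡ 0 → B % P ≢ 0 → A % P ≡ P ∸ (B % P)
  %-negation A B A+B≡0 B≢0 = +-%≡0⇒≡∸ (m%n<n A P) (m%n<n B P) (%≢0⇒1≤% B B≢0)
    (trans (sym (%-distribˡ-+ A B P)) A+B≡0)

  %≡⇒∣∸ : ∀ a b → a % P ≡ b % P → b ≤ a → P ∣ a ∸ b
  %≡⇒∣∸ a b a≡b b≤a = divides (a / P ∸ b / P) (begin
    a ∸ b                                     ≡⟨ cong₂ _∸_ (m≡m%n+[m/n]*n a P) (m≡m%n+[m/n]*n b P) ⟩
    (a % P + a / P * P) ∸ (b % P + b / P * P) ≡⟨ cong (λ z → (z + a / P * P) ∸ (b % P + b / P * P)) a≡b ⟩
    (b % P + a / P * P) ∸ (b % P + b / P * P) ≡⟨ [m+n]∸[m+o]≡n∸o (b % P) _ _ ⟩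
    a / P * P ∸ b / P * P                     ≡⟨ *-distribʳ-∸ P (a / P) (b / P) ⟨
    (a / P ∸ b / P) * P                       ∎)
    where open ≡-Reasoning

  ^-%≡1 : ∀ x → x % P ≡ 1 → ∀ t → (x ^ t) % P ≡ 1
  ^-%≡1 x x≡1 zero    = m<n⇒m%n≡m 1<P
  ^-%≡1 x x≡1 (suc t) = begin
    (x * x ^ t) % P                 ≡⟨ %-distribˡ-* x (x ^ t) P ⟩
    ((x % P) * ((x ^ t) % P)) % P   ≡⟨ cong₂ (λ a b → (a * b) % P) x≡1 (^-%≡1 x x≡1 t) ⟩
    1 % P                           ≡⟨ m<n⇒m%n≡m 1<P ⟩
    1                               ∎
    where open ≡-Reasoning

  -- P ∣ (h - 1)(h + 1)
  square-%≡1 : ∀ h → h < P → (h * h) % P ≡ 1 → h ≡ 1 ⊎ h ≡ P ∸ 1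
  square-%≡1 zero    _   ()
  square-%≡1 (suc h) h<P hh≡1 with euclidsLemma h (suc (suc h)) P-prime P∣h[h+2]
    where
    P∣h[h+2] : P ∣ h * suc (suc h)
    P∣h[h+2] = subst (P ∣_) (sym (*-suc h (suc h))) (%≡⇒∣∸ (suc h * suc h) 1 (trans hh≡1 (sym (m<n⇒m%n≡m 1<P))) (s≤s z≤n))
  ... | inj₁ P∣h with h
  ...   | zero   = inj₁ refl
  ...   | suc h′ = ⊥-elim (<⇒≱ (<-trans (n<1+n (suc h′)) h<P) (∣⇒≤ P∣h))
  square-%≡1 (suc h) h<P hh≡1 | inj₂ P∣h+2 = inj₂ (≤-antisym (≤-pred h<P) (≤-pred (∣⇒≤ P∣h+2)))

  module Generator (c : ℕ) (generator : IsGenerator P c) (2<P : 2 < P) where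

    c%≢0 : c % P ≢ 0
    c%≢0 c≡0 with generator 2 (s≤s z≤n) 2<P
    ... | zero  , 1≡2    = 1≢2 (trans (sym (m<n⇒m%n≡m 1<P)) 1≡2)
      where 1≢2 : 1 ≢ 2
            1≢2 ()
    ... | suc k , cᵏ⁺¹≡2 = 0≢2 (trans (sym (n∣m⇒m%n≡0 _ P (∣m⇒∣m*n (c ^ k) (m%n≡0⇒n∣m c P c≡0)))) cᵏ⁺¹≡2)
      where 0≢2 : 0 ≢ 2
            0≢2 ()

    c^%≢0 : ∀ k → (c ^ k) % P ≢ 0
    c^%≢0 = ^-%≢0 c c%≢0

    *-unit : ∀ {x} → 1 ≤ x → x < P → 1 ≤ (c * x) % P × (c * x) % P < P
    *-unit {x} 1≤x x<P = %≢0⇒1≤% (c * x) (*-%≢0 c x c%≢0 (unit-%≢0 1≤x x<P)) , m%n<n (c * x) P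

    *-complement : ∀ {x} → 1 ≤ x → x < P → (c * (P ∸ x)) % P ≡ P ∸ (c * x) % P
    *-complement {x} 1≤x x<P = %-negation (c * (P ∸ x)) (c * x) c[P∸x]+cx≡0 (*-%≢0 c x c%≢0 (unit-%≢0 1≤x x<P))
      where
      c[P∸x]+cx≡0 : (c * (P ∸ x) + c * x) % P ≡ 0
      c[P∸x]+cx≡0 = trans (cong (_% P) (trans (sym (*-distribˡ-+ c (P ∸ x) x)) (cong (c *_) (m∸n+n≡m (<⇒≤ x<P)))))
                          (m*n%n≡0 c P)

    ^-periodic : ∀ e → .{{_ : NonZero e}} → (c ^ e) % P ≡ 1 → ∀ k → (c ^ k) % P ≡ (c ^ (k % e)) % P
    ^-periodic e cᵉ≡1 k = begin
      (c ^ k) % P                                    ≡⟨ cong (λ z → (c ^ z) % P) (trans (m≡m%n+[m/n]*n k e) (cong (k % e +_) (*-comm (k / e) e))) ⟩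
      (c ^ (k % e + e * (k / e))) % P                ≡⟨ cong (_% P) (^-distribˡ-+-* c (k % e) (e * (k / e))) ⟩
      (c ^ (k % e) * c ^ (e * (k / e))) % P          ≡⟨ %-distribˡ-* (c ^ (k % e)) _ P ⟩
      ((c ^ (k % e)) % P * ((c ^ (e * (k / e))) % P)) % P
        ≡⟨ cong (λ z → ((c ^ (k % e)) % P * z) % P) (trans (cong (_% P) (sym (^-*-assoc c e (k / e)))) (^-%≡1 (c ^ e) cᵉ≡1 (k / e))) ⟩
      ((c ^ (k % e)) % P * 1) % P                    ≡⟨ cong (_% P) (*-identityʳ ((c ^ (k % e)) % P)) ⟩
      (c ^ (k % e)) % P % P                          ≡⟨ m%n%n≡m%n (c ^ (k % e)) P ⟩
      (c ^ (k % e)) % P                              ∎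
      where open ≡-Reasoning

    -- Distinct residues 1 … P - 1 need distinct exponents modulo e.
    order-≥ : ∀ e → 1 ≤ e → (c ^ e) % P ≡ 1 → P₁ ≤ e
    order-≥ (suc e₁) _ cᵉ≡1 = Fin.injective⇒≤ {f = exponent} exponent-injective
      where
      e = suc e₁
      log : (x : Fin P₁) → ∃[ k ] (c ^ k) % P ≡ suc (toℕ x)
      log x = generator (suc (toℕ x)) (s≤s z≤n) (s≤s (Fin.toℕ<n x))
      exponent : Fin P₁ → Fin e
      exponent x = fromℕ< (m%n<n (proj₁ (log x)) e)
      exponent-injective : Injective _≡_ _≡_ exponent
      exponent-injective {x} {y} same = Fin.toℕ-injective (suc-injective (begin
        suc (toℕ x)                     ≡⟨ proj₂ (log x) ⟨
        (c ^ proj₁ (log x)) % P         ≡⟨ ^-periodic e cᵉ≡1 (proj₁ (log x)) ⟩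
        (c ^ (proj₁ (log x) % e)) % P   ≡⟨ cong (λ z → (c ^ z) % P) same′ ⟩
        (c ^ (proj₁ (log y) % e)) % P   ≡⟨ ^-periodic e cᵉ≡1 (proj₁ (log y)) ⟨
        (c ^ proj₁ (log y)) % P         ≡⟨ proj₂ (log y) ⟩
        suc (toℕ y)                     ∎))
        where
        open ≡-Reasoning
        same′ : proj₁ (log x) % e ≡ proj₁ (log y) % e
        same′ = trans (sym (Fin.toℕ-fromℕ< _)) (trans (cong toℕ same) (Fin.toℕ-fromℕ< _))

    ^-cancelˡ : ∀ i e → (c ^ i * c ^ e) % P ≡ (c ^ i) % P → (c ^ e) % P ≡ 1
    ^-cancelˡ i e cⁱcᵉ≡cⁱ with euclidsLemma (c ^ i) (c ^ e ∸ 1) P-prime P∣cⁱ[cᵉ-1]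
      where
      1≤cᵉ = %≢0⇒1≤ (c ^ e) (c^%≢0 e)
      P∣cⁱ[cᵉ-1] : P ∣ c ^ i * (c ^ e ∸ 1)
      P∣cⁱ[cᵉ-1] = subst (P ∣_) (trans (cong (c ^ i * c ^ e ∸_) (sym (*-identityʳ (c ^ i)))) (sym (*-distribˡ-∸ (c ^ i) (c ^ e) 1)))
        (%≡⇒∣∸ (c ^ i * c ^ e) (c ^ i) cⁱcᵉ≡cⁱ (≤-trans (≤-reflexive (sym (*-identityʳ (c ^ i)))) (*-monoʳ-≤ (c ^ i) 1≤cᵉ)))
    ... | inj₁ P∣cⁱ    = ⊥-elim (%≢0⇒∤ (c ^ i) (c^%≢0 i) P∣cⁱ)
    ... | inj₂ P∣cᵉ-1 = trans (cong (_% P) (sym (m∸n+n≡m (%≢0⇒1≤ (c ^ e) (c^%≢0 e)))))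
                              (trans (%-remove-+ˡ 1 P∣cᵉ-1) (m<n⇒m%n≡m 1<P))

    residue-1 : Fin P → Fin P₁
    residue-1 k = fromℕ< (∸-monoˡ-< (m%n<n (c ^ toℕ k) P) (%≢0⇒1≤% (c ^ toℕ k) (c^%≢0 (toℕ k))))

    period : ∃[ e ] 1 ≤ e × e ≤ P₁ × (c ^ e) % P ≡ 1
    period with Fin.pigeonhole (n<1+n P₁) residue-1
    ... | i , j , i<j , same = toℕ j ∸ toℕ i , m<n⇒0<n∸m i<j , ≤-trans (m∸n≤m (toℕ j) (toℕ i)) (≤-pred (Fin.toℕ<n j)) ,
                               ^-cancelˡ (toℕ i) (toℕ j ∸ toℕ i) cⁱcʲ⁻ⁱ≡cⁱ
      where
      cʲ≡cⁱ : (c ^ toℕ j) % P ≡ (c ^ toℕ i) % P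
      cʲ≡cⁱ = sym (trans (sym (m∸n+n≡m (%≢0⇒1≤% (c ^ toℕ i) (c^%≢0 (toℕ i)))))
                   (trans (cong (_+ 1) (trans (sym (Fin.toℕ-fromℕ< _)) (trans (cong toℕ same) (Fin.toℕ-fromℕ< _))))
                          (m∸n+n≡m (%≢0⇒1≤% (c ^ toℕ j) (c^%≢0 (toℕ j))))))
      cⁱcʲ⁻ⁱ≡cⁱ : (c ^ toℕ i * c ^ (toℕ j ∸ toℕ i)) % P ≡ (c ^ toℕ i) % P
      cⁱcʲ⁻ⁱ≡cⁱ = trans (cong (_% P) (sym (^-distribˡ-+-* c (toℕ i) _)))
                         (trans (cong (λ z → (c ^ z) % P) (m+[n∸m]≡n (<⇒≤ i<j))) cʲ≡cⁱ)

    fermat : (c ^ P₁) % P ≡ 1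
    fermat with period
    ... | e , 1≤e , e≤P₁ , cᵉ≡1 = subst (λ z → (c ^ z) % P ≡ 1) (≤-antisym e≤P₁ (order-≥ e 1≤e cᵉ≡1)) cᵉ≡1

    half-bounds : ∀ m → m + m ≡ P₁ → 1 ≤ m × m < P₁
    half-bounds zero    0≡P₁   = ⊥-elim (<⇒≱ 2<P (subst (λ z → suc z ≤ 2) 0≡P₁ (s≤s z≤n)))
    half-bounds (suc m) m+m≡P₁ = s≤s z≤n , subst (suc m <_) m+m≡P₁ (m<m+n (suc m) (s≤s z≤n))

    -- c^m is a square root of 1 other than 1, because m < P - 1 is below the order of c.
    half-power : ∀ m → m + m ≡ P₁ → (c ^ m) % P ≡ P₁
    half-power m m+m≡P₁ with square-%≡1 ((c ^ m) % P) (m%n<n (c ^ m) P) cᵐcᵐ≡1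
      where
      cᵐcᵐ≡1 : ((c ^ m) % P * ((c ^ m) % P)) % P ≡ 1
      cᵐcᵐ≡1 = trans (sym (%-distribˡ-* (c ^ m) (c ^ m) P))
                     (trans (cong (_% P) (sym (^-distribˡ-+-* c m m))) (trans (cong (λ z → (c ^ z) % P) m+m≡P₁) fermat))
    ... | inj₁ cᵐ≡1  = ⊥-elim (<⇒≱ (proj₂ (half-bounds m m+m≡P₁)) (order-≥ m (proj₁ (half-bounds m m+m≡P₁)) cᵐ≡1))
    ... | inj₂ cᵐ≡P₁ = cᵐ≡P₁

    scale : ℕ → ℕ
    scale x = (c * x) % P

    fold-scale : ∀ k → 1 ≤ k → ∀ x → fold x scale k ≡ (c ^ k * x) % P
    fold-scale (suc zero)    _ x = cong (λ z → (z * x) % P) (sym (*-identityʳ c))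
    fold-scale (suc (suc k)) _ x = begin
      (c * fold x scale (suc k)) % P   ≡⟨ cong (λ z → (c * z) % P) (fold-scale (suc k) (s≤s z≤n) x) ⟩
      (c * ((c ^ suc k * x) % P)) % P    ≡⟨ *-%-congʳ c (c ^ suc k * x) ⟩
      (c * (c ^ suc k * x)) % P          ≡⟨ cong (_% P) (*-assoc c (c ^ suc k) x) ⟨
      (c ^ suc (suc k) * x) % P          ∎
      where open ≡-Reasoning

    fold-scale-half : ∀ m → m + m ≡ P₁ → ∀ {x} → 1 ≤ x → x < P → fold x scale m ≡ P ∸ x
    fold-scale-half m m+m≡P₁ {x} 1≤x x<P = begin
      fold x scale m                    ≡⟨ fold-scale m (proj₁ (half-bounds m m+m≡P₁)) x ⟩
      (c ^ m * x) % P                     ≡⟨ %-distribˡ-* (c ^ m) x P ⟩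
      ((c ^ m) % P * (x % P)) % P         ≡⟨ cong₂ (λ a b → (a * b) % P) (half-power m m+m≡P₁) x%P≡x ⟩
      (P₁ * x) % P                        ≡⟨ %-negation (P₁ * x) x P₁x+x≡0 (unit-%≢0 1≤x x<P) ⟩
      P ∸ x % P                           ≡⟨ cong (P ∸_) x%P≡x ⟩
      P ∸ x                               ∎
      where
      open ≡-Reasoning
      x%P≡x : x % P ≡ x
      x%P≡x = m<n⇒m%n≡m x<P
      P₁x+x≡0 : (P₁ * x + x) % P ≡ 0
      P₁x+x≡0 = trans (cong (_% P) (trans (+-comm (P₁ * x) x) (*-comm P x))) (m*n%n≡0 x P)

-- The pair (a , b) is encoded by the lattice point (a + 1 , b) strictly above the diagonal
-- q x = p y of the rectangle [1, p - 1] × [1, q - 1]; the points below it are the images of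
-- those above under the point reflection (x , y) ↦ (p - x , q - y).
module LatticePoints (p₁ q₁ : ℕ) (p-prime : Prime (suc p₁)) (q-prime : Prime (suc q₁))
                     (p≢q : suc p₁ ≢ suc q₁) where
  open import Data.Bool using (Bool; true; false; not; if_then_else_)
  open import Data.Bool.Properties using (T-≡)
  open import Data.Nat
  open import Data.Nat.Properties
  open import Data.Nat.DivMod
  open import Data.Nat.Divisibility
  open import Data.Nat.Primality
  open import Data.List using (List; map; concat; upTo; applyUpTo; length)
  import Data.List.Properties as List
  open import Data.Product using (_×_; _,_; proj₁; proj₂; ∃-syntax)
  open import Data.Sum using (inj₁; inj₂)
  open import Function using (_∘_; Equivalence)
  open import Relation.Binary.PropositionalEquality
  open import Relation.Nullary using (¬_; yes; no)
  open Arithmetic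

  p q : ℕ
  p = suc p₁
  q = suc q₁

  open Data p q
  module Modq = PrimeResidues q₁ q-prime

  Point : ℕ → ℕ → Set
  Point x y = 1 ≤ x × x < p × 1 ≤ y × y < q

  reflect-point : ∀ {x y} → Point x y → Point (p ∸ x) (q ∸ y)
  reflect-point (1≤x , x<p , 1≤y , y<q) =
    m<n⇒0<n∸m x<p , ∸-monoʳ-< 1≤x (<⇒≤ x<p) , m<n⇒0<n∸m y<q , ∸-monoʳ-< 1≤y (<⇒≤ y<q)

  reflectˣ-point : ∀ {x y} → Point x y → Point (p ∸ x) y
  reflectˣ-point (1≤x , x<p , 1≤y , y<q) = m<n⇒0<n∸m x<p , ∸-monoʳ-< 1≤x (<⇒≤ x<p) , 1≤y , y<q

  p∤q : ¬ p ∣ q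
  p∤q p∣q with prime⇒irreducible q-prime p∣q
  ... | inj₁ p≡1 = nonTrivial⇒≢1 {{prime⇒nonTrivial p-prime}} p≡1
  ... | inj₂ p≡q = p≢q p≡q

  p%q≢0 : p % q ≢ 0
  p%q≢0 p%q≡0 with prime⇒irreducible p-prime (m%n≡0⇒n∣m p q p%q≡0)
  ... | inj₁ q≡1 = nonTrivial⇒≢1 {{prime⇒nonTrivial q-prime}} q≡1
  ... | inj₂ q≡p = p≢q (sym q≡p)

  qx≢py : ∀ {x y} → Point x y → q * x ≢ p * y
  qx≢py {x} {y} (1≤x , x<p , _) qx≡py with euclidsLemma q x p-prime (subst (p ∣_) (sym qx≡py) (m∣m*n y))
  ... | inj₁ p∣q = p∤q p∣q
  ... | inj₂ p∣x = <⇒≱ x<p (∣⇒≤ {{>-nonZero 1≤x}} p∣x)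

  above : ℕ → ℕ → Bool
  above x y = q * x <ᵇ p * y

  above-reflect : ∀ {x y} → Point x y → above (p ∸ x) (q ∸ y) ≡ not (above x y)
  above-reflect {x} {y} pt@(1≤x , x<p , 1≤y , y<q) with q * x <? p * y
  ... | yes qx<py = trans (<ᵇ-false (<-asym (reflect-< qx<py))) (sym (cong not (<ᵇ-true qx<py)))
    where
    reflect-< : q * x < p * y → p * (q ∸ y) < q * (p ∸ x)
    reflect-< lt = subst₂ _<_ (sym (*-distribˡ-∸ p q y)) (trans (cong (_∸ q * x) (*-comm p q)) (sym (*-distribˡ-∸ q p x)))
                     (∸-monoʳ-< lt (*-monoʳ-≤ p (<⇒≤ y<q)))
  ... | no  qx≮py = trans (<ᵇ-true reflected) (sym (cong not (<ᵇ-false qx≮py)))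
    where
    py<qx : p * y < q * x
    py<qx = ≤∧≢⇒< (≮⇒≥ qx≮py) (λ py≡qx → qx≢py pt (sym py≡qx))
    reflected : q * (p ∸ x) < p * (q ∸ y)
    reflected = subst₂ _<_ (trans (cong (_∸ q * x) (*-comm p q)) (sym (*-distribˡ-∸ q p x))) (sym (*-distribˡ-∸ p q y))
                  (∸-monoʳ-< py<qx (≤-trans (*-monoʳ-≤ q (<⇒≤ x<p)) (≤-reflexive (*-comm q p))))

  cnt-above : ∀ {x} y → 1 ≤ x → ((x ∸ 1) <ᵇ cnt y) ≡ above x y
  cnt-above {suc x} y _ = <ᵇ⇔ to from
    where
    to : x < cnt y → q * suc x < p * y
    to x<cnt = ≤∸1⇒< (s≤s z≤n)
                 (≤-trans (≤-reflexive (*-comm q (suc x))) (≤-trans (*-monoˡ-≤ q x<cnt) (m/n*n≤m (p * y ∸ 1) q)))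
    from : q * suc x < p * y → x < cnt y
    from qx<py = ≤-trans (≤-reflexive (sym (m*n/n≡m (suc x) q)))
                   (/-monoˡ-≤ q (≤-trans (≤-reflexive (*-comm (suc x) q)) (<⇒≤∸1 qx<py)))

  cnt≡quotient : ∀ b → (p * b) % q ≢ 0 → cnt b ≡ (p * b) / q
  cnt≡quotient b ρ≢0 = begin
    (p * b ∸ 1) / q             ≡⟨ cong (λ z → (z ∸ 1) / q) (m≡m%n+[m/n]*n (p * b) q) ⟩
    (ρ + A * q ∸ 1) / q         ≡⟨ cong (_/ q) (+-∸-comm (A * q) 1≤ρ) ⟩
    (ρ ∸ 1 + A * q) / q         ≡⟨ +-distrib-/-∣ʳ (ρ ∸ 1) (n∣m*n A) ⟩
    (ρ ∸ 1) / q + A * q / q     ≡⟨ cong₂ _+_ (m<n⇒m/n≡0 (≤-<-trans (m∸n≤m ρ 1) (m%n<n (p * b) q))) (m*n/n≡m A q) ⟩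
    A                           ∎
    where
    open ≡-Reasoning
    ρ = (p * b) % q
    A = (p * b) / q
    1≤ρ = Modq.%≢0⇒1≤% (p * b) ρ≢0

  -- The remainders of p b and p (q - b) are nonzero and add up to q, so the quotients add up to p - 1.
  cnt-complement : ∀ {b} → 1 ≤ b → b < q → cnt b + cnt (q ∸ b) ≡ p ∸ 1
  cnt-complement {b} 1≤b b<q = begin
    cnt b + cnt (q ∸ b) ≡⟨ cong₂ _+_ (cnt≡quotient b ρ≢0) (cnt≡quotient (q ∸ b) ρ′≢0) ⟩
    A + A′              ≡⟨ cong (_∸ 1) 1+A+A′≡p ⟩
    p ∸ 1               ∎
    where
    open ≡-Reasoning
    N N′ ρ ρ′ A A′ : ℕ
    N  = p * b
    N′ = p * (q ∸ b)
    ρ  = N % q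
    ρ′ = N′ % q
    A  = N / q
    A′ = N′ / q
    ρ≢0 : ρ ≢ 0
    ρ≢0 = Modq.*-%≢0 p b p%q≢0 (Modq.unit-%≢0 1≤b b<q)
    ρ′≢0 : ρ′ ≢ 0
    ρ′≢0 = Modq.*-%≢0 p (q ∸ b) p%q≢0 (Modq.unit-%≢0 (m<n⇒0<n∸m b<q) (∸-monoʳ-< 1≤b (<⇒≤ b<q)))
    N+N′≡pq : N + N′ ≡ p * q
    N+N′≡pq = trans (sym (*-distribˡ-+ p b (q ∸ b))) (cong (p *_) (m+[n∸m]≡n (<⇒≤ b<q)))
    ρ′+ρ≡0 : (ρ′ + ρ) % q ≡ 0
    ρ′+ρ≡0 = trans (sym (%-distribˡ-+ N′ N q)) (trans (cong (_% q) (trans (+-comm N′ N) N+N′≡pq)) (m*n%n≡0 p q))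
    ρ+ρ′≡q : ρ + ρ′ ≡ q
    ρ+ρ′≡q = trans (cong (ρ +_) (Modq.+-%≡0⇒≡∸ (m%n<n N′ q) (m%n<n N q) (Modq.%≢0⇒1≤% N ρ≢0) ρ′+ρ≡0))
                   (m+[n∸m]≡n (<⇒≤ (m%n<n N q)))
    1+A+A′≡p : suc (A + A′) ≡ p
    1+A+A′≡p = *-cancelʳ-≡ (suc (A + A′)) p q (begin
      q + (A + A′) * q              ≡⟨ cong₂ _+_ (sym ρ+ρ′≡q) (*-distribʳ-+ q A A′) ⟩
      (ρ + ρ′) + (A * q + A′ * q)   ≡⟨ +-interchange ρ ρ′ (A * q) (A′ * q) ⟩
      (ρ + A * q) + (ρ′ + A′ * q)   ≡⟨ cong₂ _+_ (m≡m%n+[m/n]*n N q) (m≡m%n+[m/n]*n N′ q) ⟨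
      N + N′                        ≡⟨ N+N′≡pq ⟩
      p * q                         ∎)

  κ-total : κ (q ∸ 1) + κ (q ∸ 1) ≡ (q ∸ 1) * (p ∸ 1)
  κ-total = begin
    κ q₁ + κ q₁                                                ≡⟨ cong (κ q₁ +_) (sumℕ-reverse q₁ (cnt ∘ suc)) ⟩
    κ q₁ + sumℕ q₁ (λ i → cnt (suc (q₁ ∸ suc i)))              ≡⟨ cong (κ q₁ +_) (sumℕ-cong q₁ (λ i i<q₁ → cong cnt (sym (+-∸-assoc 1 i<q₁)))) ⟩
    κ q₁ + sumℕ q₁ (λ i → cnt (q ∸ suc i))                     ≡⟨ sumℕ-distrib-+ q₁ _ _ ⟨
    sumℕ q₁ (λ i → cnt (suc i) + cnt (q ∸ suc i))              ≡⟨ sumℕ-cong q₁ (λ i i<q₁ → cnt-complement (s≤s z≤n) (s≤s i<q₁)) ⟩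
    sumℕ q₁ (λ _ → p ∸ 1)                                      ≡⟨ sumℕ-const q₁ (p ∸ 1) ⟩
    q₁ * (p ∸ 1)                                               ∎
    where open ≡-Reasoning

  g≡κ : g ≡ κ (q ∸ 1)
  g≡κ = begin
    ((p ∸ 1) * (q ∸ 1)) / 2       ≡⟨ cong (_/ 2) (trans (*-comm (p ∸ 1) (q ∸ 1)) (sym κ-total)) ⟩
    (κ q₁ + κ q₁) / 2             ≡⟨ cong (_/ 2) (trans (cong (κ q₁ +_) (sym (+-identityʳ (κ q₁)))) (*-comm 2 (κ q₁))) ⟩
    (κ q₁ * 2) / 2                ≡⟨ m*n/n≡m (κ q₁) 2 ⟩
    κ q₁                          ∎
    where open ≡-Reasoning

  pairsWith : ℕ → List (ℕ × ℕ)
  pairsWith b = map (λ a → (a , b)) (upTo (cnt b))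

  pairs≡concat : pairs ≡ concat (applyUpTo (pairsWith ∘ suc) q₁)
  pairs≡concat = cong concat (trans (cong (map pairsWith) (List.map-applyUpTo (λ i → i) suc q₁))
                                    (List.map-applyUpTo suc pairsWith q₁))

  length-pairsWith : ∀ b → length (pairsWith b) ≡ cnt b
  length-pairsWith b = trans (List.length-map _ (upTo (cnt b))) (List.length-applyUpTo (λ i → i) (cnt b))

  nth-pairs : ∀ {j a} → j < q₁ → a < cnt (suc j) → nth (0 , 0) pairs (κ j + a) ≡ (a , suc j)
  nth-pairs {j} {a} j<q₁ a<cnt = begin
    nth (0 , 0) pairs (κ j + a)
      ≡⟨ cong₂ (nth (0 , 0)) pairs≡concat (cong (_+ a) (sumℕ-cong j (λ i _ → sym (length-pairsWith (suc i))))) ⟩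
    nth (0 , 0) (concat (applyUpTo (pairsWith ∘ suc) q₁)) (sumℕ j (length ∘ pairsWith ∘ suc) + a)
      ≡⟨ nth-concat (0 , 0) (pairsWith ∘ suc) q₁ j<q₁ (subst (a <_) (sym (length-pairsWith (suc j))) a<cnt) ⟩
    nth (0 , 0) (pairsWith (suc j)) a
      ≡⟨ cong (λ xs → nth (0 , 0) xs a) (List.map-applyUpTo (λ i → i) _ (cnt (suc j))) ⟩
    nth (0 , 0) (applyUpTo (λ a → (a , suc j)) (cnt (suc j))) a
      ≡⟨ nth-applyUpTo (0 , 0) _ (cnt (suc j)) a<cnt ⟩
    (a , suc j)                                    ∎
    where open ≡-Reasoning

  pairIndex : ℕ → ℕ → ℕ
  pairIndex x y = if above x y then κ (y ∸ 1) + (x ∸ 1) else κ (q ∸ y ∸ 1) + (p ∸ x ∸ 1)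

  pairIndex-reflect : ∀ {x y} → Point x y → pairIndex (p ∸ x) (q ∸ y) ≡ pairIndex x y
  pairIndex-reflect {x} {y} pt@(_ , x<p , _ , y<q) =
    trans (cong (if_then below else reflected) (above-reflect pt)) (by-cases (above x y))
    where
    below reflected : ℕ
    below     = κ (q ∸ y ∸ 1) + (p ∸ x ∸ 1)
    reflected = κ (q ∸ (q ∸ y) ∸ 1) + (p ∸ (p ∸ x) ∸ 1)
    by-cases : ∀ b → (if not b then below else reflected) ≡ (if b then κ (y ∸ 1) + (x ∸ 1) else below)
    by-cases true  = cong₂ (λ u w → κ (u ∸ 1) + (w ∸ 1)) (m∸[m∸n]≡n (<⇒≤ y<q)) (m∸[m∸n]≡n (<⇒≤ x<p))
    by-cases false = refl

  module _ {x y} (pt : Point x y) (is-above : above x y ≡ true) where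
    private
      y∸1<q₁ : y ∸ 1 < q₁
      y∸1<q₁ = ∸-monoˡ-< (proj₂ (proj₂ (proj₂ pt))) (proj₁ (proj₂ (proj₂ pt)))
      x∸1<cnt : x ∸ 1 < cnt (suc (y ∸ 1))
      x∸1<cnt = subst (λ z → x ∸ 1 < cnt z) (sym (m+[n∸m]≡n (proj₁ (proj₂ (proj₂ pt)))))
                  (<ᵇ⇒< (x ∸ 1) (cnt y) (Equivalence.from T-≡ (trans (cnt-above y (proj₁ pt)) is-above)))

    pair-pairIndex-above : nth (0 , 0) pairs (pairIndex x y) ≡ (x ∸ 1 , y)
    pair-pairIndex-above rewrite is-above =
      subst (λ z → nth (0 , 0) pairs (κ (y ∸ 1) + (x ∸ 1)) ≡ (x ∸ 1 , z)) (m+[n∸m]≡n (proj₁ (proj₂ (proj₂ pt))))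
        (nth-pairs y∸1<q₁ x∸1<cnt)

    pairIndex<g-above : pairIndex x y < g
    pairIndex<g-above rewrite is-above | g≡κ =
      ≤-trans (+-monoʳ-< (κ (y ∸ 1)) x∸1<cnt) (sumℕ-mono (cnt ∘ suc) y∸1<q₁)

  pairIndex<g : ∀ {x y} → Point x y → pairIndex x y < g
  pairIndex<g {x} {y} pt = by-cases (above x y) refl
    where
    by-cases : ∀ b → above x y ≡ b → pairIndex x y < g
    by-cases true  is-above = pairIndex<g-above pt is-above
    by-cases false is-below = subst (_< g) (pairIndex-reflect pt)
      (pairIndex<g-above (reflect-point pt) (trans (above-reflect pt) (cong not is-below)))

  pairIndex-surjective : ∀ {i} → i < g → ∃[ x ] ∃[ y ] Point x y × pairIndex x y ≡ i
  pairIndex-surjective {i} i<g with sumℕ-decompose q₁ (cnt ∘ suc) (subst (i <_) g≡κ i<g)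
  ... | j , a , j<q₁ , a<cnt , i≡ = suc a , suc j , (s≤s z≤n , a+1<p , s≤s z≤n , s≤s j<q₁) ,
    trans (cong (if_then κ j + a else κ (q ∸ suc j ∸ 1) + (p ∸ suc a ∸ 1)) is-above) (sym i≡)
    where
    is-above : above (suc a) (suc j) ≡ true
    is-above = trans (sym (cnt-above (suc j) (s≤s z≤n))) (<ᵇ-true a<cnt)
    a+1<p : suc a < p
    a+1<p = *-cancelˡ-< q (suc a) p (begin-strict
      q * suc a     <⟨ <ᵇ⇒< (q * suc a) (p * suc j) (Equivalence.from T-≡ is-above) ⟩
      p * suc j     ≤⟨ *-monoʳ-≤ p (m≤n⇒m≤1+n j<q₁) ⟩
      p * q         ≡⟨ *-comm p q ⟩
      q * p         ∎)
      where open ≤-Reasoning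

module _ {p q : ℕ} where
  open import Data.Bool using (Bool; if_then_else_)
  open Data p q

  blockShape : Bool → Block
  blockShape f = if f then 𝕁 else 𝕀

module GammaBlocks (p₁ q₁ : ℕ) (p-prime : Prime (suc p₁)) (q-prime : Prime (suc q₁))
                   (p≢q : suc p₁ ≢ suc q₁) where
  open import Data.Bool using (true; false; not; if_then_else_; _xor_)
  open import Data.Bool.Properties using (not-involutive)
  open import Data.Nat
  open import Data.Nat.Properties
  open import Data.Product using (_,_; proj₁; proj₂)
  open import Relation.Binary.PropositionalEquality

  open LatticePoints p₁ q₁ p-prime q-prime p≢q
  open Data p q

  -- The block of γ_q in block row (a , t), and of γ_p in block row (s , b), both have this form.
  blockFormula : ℕ → ℕ → ℕ → Block
  blockFormula a t j =
    if a <ᵇ cnt t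
    then (if j ≡ᵇ (κ (t ∸ 1) + a + 1) then 𝕀 else 𝟘)
    else (if j ≡ᵇ (κ (q ∸ t ∸ 1) + (p ∸ (a + 1))) then 𝕁 else 𝟘)

  blockFormula-pairIndex : ∀ {x} t → 1 ≤ x → x < p → ∀ j →
    blockFormula (x ∸ 1) t j ≡ (if j ≡ᵇ suc (pairIndex x t) then blockShape (not (above x t)) else 𝟘)
  blockFormula-pairIndex {x} t 1≤x x<p j rewrite cnt-above t 1≤x with above x t
  ... | true  = cong (λ k → if j ≡ᵇ k then 𝕀 else 𝟘) (+-comm _ 1)
  ... | false = cong (λ k → if j ≡ᵇ k then 𝕁 else 𝟘) (begin
    κ (q ∸ t ∸ 1) + (p ∸ (x ∸ 1 + 1))      ≡⟨ cong (λ z → κ (q ∸ t ∸ 1) + (p ∸ z)) (m∸n+n≡m 1≤x) ⟩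
    κ (q ∸ t ∸ 1) + (p ∸ x)                ≡⟨ cong (κ (q ∸ t ∸ 1) +_) (m+[n∸m]≡n (m<n⇒0<n∸m x<p)) ⟨
    κ (q ∸ t ∸ 1) + suc (p ∸ x ∸ 1)        ≡⟨ +-suc _ _ ⟩
    suc (κ (q ∸ t ∸ 1) + (p ∸ x ∸ 1))      ∎)
    where open ≡-Reasoning

  module Gamma-q (d : ℕ) (d-generator : IsGenerator q d) (2<q : 2 < q) where
    open PrimeResidues.Generator q₁ q-prime d d-generator 2<q

    scale-point : ∀ {x y} → Point x y → Point x (scale y)
    scale-point (1≤x , x<p , 1≤y , y<q) = 1≤x , x<p , *-unit 1≤y y<q

    γq-block-above : ∀ {x y} → Point x y → above x y ≡ true → ∀ j →
                     γq-block d (suc (pairIndex x y)) j ≡ blockFormula (x ∸ 1) (scale y) j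
    γq-block-above pt is-above j =
      cong (λ pair → blockFormula (proj₁ pair) (scale (proj₂ pair)) j) (pair-pairIndex-above pt is-above)

    γq-block-point : ∀ {x y} → Point x y → ∀ j →
      γq-block d (suc (pairIndex x y)) j ≡ (if j ≡ᵇ suc (pairIndex x (scale y)) then blockShape (above x y xor above x (scale y)) else 𝟘)
    γq-block-point {x} {y} pt@(1≤x , x<p , 1≤y , y<q) j = by-cases (above x y) refl
      where
      by-cases : ∀ b → above x y ≡ b →
        γq-block d (suc (pairIndex x y)) j ≡ (if j ≡ᵇ suc (pairIndex x (scale y)) then blockShape (b xor above x (scale y)) else 𝟘)
      by-cases true  is-above = trans (γq-block-above pt is-above j) (blockFormula-pairIndex (scale y) 1≤x x<p j)
      by-cases false is-below = begin
        γq-block d (suc (pairIndex x y)) j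
          ≡⟨ cong (λ i → γq-block d (suc i) j) (sym (pairIndex-reflect pt)) ⟩
        γq-block d (suc (pairIndex (p ∸ x) (q ∸ y))) j
          ≡⟨ γq-block-above (reflect-point pt) (trans (above-reflect pt) (cong not is-below)) j ⟩
        blockFormula (p ∸ x ∸ 1) (scale (q ∸ y)) j
          ≡⟨ cong (λ t → blockFormula (p ∸ x ∸ 1) t j) (*-complement 1≤y y<q) ⟩
        blockFormula (p ∸ x ∸ 1) (q ∸ scale y) j
          ≡⟨ blockFormula-pairIndex (q ∸ scale y) (proj₁ (reflect-point pt)) (proj₁ (proj₂ (reflect-point pt))) j ⟩
        (if j ≡ᵇ suc (pairIndex (p ∸ x) (q ∸ scale y)) then blockShape (not (above (p ∸ x) (q ∸ scale y))) else 𝟘)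
          ≡⟨ cong₂ (λ i f → if j ≡ᵇ suc i then blockShape f else 𝟘)
                   (pairIndex-reflect (scale-point pt))
                   (trans (cong not (above-reflect (scale-point pt))) (not-involutive _)) ⟩
        (if j ≡ᵇ suc (pairIndex x (scale y)) then blockShape (above x (scale y)) else 𝟘) ∎
        where open ≡-Reasoning

  module Gamma-p (c : ℕ) (c-generator : IsGenerator p c) (2<p : 2 < p) where
    open PrimeResidues.Generator p₁ p-prime c c-generator 2<p

    scale-point : ∀ {x y} → Point x y → Point (scale x) y
    scale-point (1≤x , x<p , 1≤y , y<q) = proj₁ (*-unit 1≤x x<p) , proj₂ (*-unit 1≤x x<p) , 1≤y , y<q

    γp-block-above : ∀ {x y} → Point x y → above x y ≡ true → ∀ j →
                     γp-block c (suc (pairIndex x y)) j ≡ blockFormula (scale x ∸ 1) y j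
    γp-block-above {x} {y} pt@(1≤x , x<p , _) is-above j = begin
      γp-block c (suc (pairIndex x y)) j
        ≡⟨ cong (λ pair → γp-formula (proj₁ pair) (proj₂ pair)) (pair-pairIndex-above pt is-above) ⟩
      γp-formula (x ∸ 1) y
        ≡⟨ cong (λ z → γp-formula′ ((c * z) % p) y) (m∸n+n≡m 1≤x) ⟩
      γp-formula′ (scale x) y
        ≡⟨ cong (if_then 𝟘 else blockFormula (scale x ∸ 1) y j) (scale≢0 (proj₁ (*-unit 1≤x x<p))) ⟩
      blockFormula (scale x ∸ 1) y j ∎
      where
      open ≡-Reasoning
      γp-formula′ : ℕ → ℕ → Block
      γp-formula′ r b = if r ≡ᵇ 0 then 𝟘 else blockFormula (r ∸ 1) b j
      γp-formula : ℕ → ℕ → Block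
      γp-formula a b = γp-formula′ ((c * (a + 1)) % p) b
      scale≢0 : ∀ {r} → 1 ≤ r → (r ≡ᵇ 0) ≡ false
      scale≢0 (s≤s _) = refl

    γp-block-point : ∀ {x y} → Point x y → ∀ j →
      γp-block c (suc (pairIndex x y)) j ≡ (if j ≡ᵇ suc (pairIndex (scale x) y) then blockShape (above x y xor above (scale x) y) else 𝟘)
    γp-block-point {x} {y} pt@(1≤x , x<p , 1≤y , y<q) j = by-cases (above x y) refl
      where
      pt′ = scale-point pt
      by-cases : ∀ b → above x y ≡ b →
        γp-block c (suc (pairIndex x y)) j ≡ (if j ≡ᵇ suc (pairIndex (scale x) y) then blockShape (b xor above (scale x) y) else 𝟘)
      by-cases true  is-above =
        trans (γp-block-above pt is-above j) (blockFormula-pairIndex y (proj₁ pt′) (proj₁ (proj₂ pt′)) j)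
      by-cases false is-below = begin
        γp-block c (suc (pairIndex x y)) j
          ≡⟨ cong (λ i → γp-block c (suc i) j) (sym (pairIndex-reflect pt)) ⟩
        γp-block c (suc (pairIndex (p ∸ x) (q ∸ y))) j
          ≡⟨ γp-block-above (reflect-point pt) (trans (above-reflect pt) (cong not is-below)) j ⟩
        blockFormula (scale (p ∸ x) ∸ 1) (q ∸ y) j
          ≡⟨ cong (λ z → blockFormula (z ∸ 1) (q ∸ y) j) (*-complement 1≤x x<p) ⟩
        blockFormula (p ∸ scale x ∸ 1) (q ∸ y) j
          ≡⟨ blockFormula-pairIndex (q ∸ y) (proj₁ (reflect-point pt′)) (proj₁ (proj₂ (reflect-point pt′))) j ⟩
        (if j ≡ᵇ suc (pairIndex (p ∸ scale x) (q ∸ y)) then blockShape (not (above (p ∸ scale x) (q ∸ y))) else 𝟘)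
          ≡⟨ cong₂ (λ i f → if j ≡ᵇ suc i then blockShape f else 𝟘)
                   (pairIndex-reflect pt′) (trans (cong not (above-reflect pt′)) (not-involutive _)) ⟩
        (if j ≡ᵇ suc (pairIndex (scale x) y) then blockShape (above (scale x) y) else 𝟘) ∎
        where open ≡-Reasoning

module BlockMatrices {c ℓ : Level} (R : CommutativeRing c ℓ) (p q : ℕ) where
  open Arithmetic using (≡ᵇ-sym)
  open BlockIndexing
  open import Data.Bool using (true; false; not; if_then_else_; _xor_; _∧_)
  open import Data.Nat using (suc; _≡ᵇ_)
  open import Data.Product using (_,_)
  import Relation.Binary.PropositionalEquality as ≡
  open CommutativeRing R
  open OverRing R
  open OverRing.Mats R p q
  open MonomialRows R

  blockEntry-blockShape : ∀ f δ ε →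
    blockEntry (blockShape f) (blockRow 0 δ) (blockRow 0 ε)
      ≈ (if (if ε then δ xor f else not (δ xor f)) then sign (false xor (f ∧ δ)) else 0#)
  blockEntry-blockShape false false false = refl
  blockEntry-blockShape false false true  = refl
  blockEntry-blockShape false true  false = refl
  blockEntry-blockShape false true  true  = refl
  blockEntry-blockShape true  false false = refl
  blockEntry-blockShape true  false true  = refl
  blockEntry-blockShape true  true  false = refl
  blockEntry-blockShape true  true  true  = refl

  fromBlocks-monomialBlockRow : ∀ (B : ℕ → ℕ → Block) i j f →
    (∀ s → B (suc i) s ≡.≡ (if s ≡ᵇ suc j then blockShape f else 𝟘)) →
    MonomialBlockRow (fromBlocks B) i j f false
  fromBlocks-monomialBlockRow B i j f row-i = monomialBlockRow entry
    where
    entry : ∀ δ s → fromBlocks B (blockRow i δ) s ≈ (if s ≡ᵇ blockRow j (δ xor f) then sign (false xor (f ∧ δ)) else 0#)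
    entry δ s with blockRow-surjective s
    ... | k , ε , ≡.refl
      rewrite blockRow/2 i δ | blockRow%2 i δ | blockRow/2 k ε | blockRow%2 k ε | row-i (suc k)
            | blockRow-≡ᵇ k ε j (δ xor f) with k ≡ᵇ j
    ...   | false = refl
    ...   | true  = blockEntry-blockShape f δ ε

  diagU-row : ∀ u v i δ → MonomialRow (diagU u v) (blockRow i δ) (blockRow i δ) (if δ then v i else u i)
  diagU-row u v i δ s rewrite blockRow/2 i δ | blockRow%2 i δ | ≡ᵇ-sym (blockRow i δ) s with s ≡ᵇ blockRow i δ
  ... | false = refl
  ... | true with δ
  ...   | false = refl
  ...   | true  = refl

module Proposition {c′ ℓ : Level} (R : CommutativeRing c′ ℓ) (p₁ q₁ : ℕ)
  (p-prime : Prime (suc p₁)) (q-prime : Prime (suc q₁)) (p-odd : Odd (suc p₁)) (q-odd : Odd (suc q₁))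
  (p≢q : suc p₁ ≢ suc q₁) (2<p : 2 < suc p₁) (2<q : 2 < suc q₁)
  (c d : ℕ) (c-generator : IsGenerator (suc p₁) c) (d-generator : IsGenerator (suc q₁) d) where

  open Arithmetic
  open BlockIndexing
  open BooleanSigns

  open import Data.Bool using (Bool; true; _xor_; _∧_)
  open import Data.Bool.Properties using (xor-inverseʳ)
  import Data.Nat as ℕ
  open import Data.Product using (_×_; _,_; ∃-syntax)
  import Relation.Binary.PropositionalEquality as ≡

  open CommutativeRing R
  open OverRing R
  open OverRing.Mats R (suc p₁) (suc q₁)
  open MonomialRows R
  open AntidiagonalCharPoly R
  open BlockMatrices R (suc p₁) (suc q₁)
  open LatticePoints p₁ q₁ p-prime q-prime p≢q
  open GammaBlocks p₁ q₁ p-prime q-prime p≢q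
  module Cp = PrimeResidues.Generator p₁ p-prime c c-generator 2<p
  module Cq = PrimeResidues.Generator q₁ q-prime d d-generator 2<q
  module Γp = Gamma-p c c-generator 2<p
  module Γq = Gamma-q d d-generator 2<q

  blockRow<dim : ∀ {x y} → Point x y → ∀ δ → blockRow (pairIndex x y) δ < dim
  blockRow<dim pt δ = blockRow< δ (pairIndex<g pt)

  γp^m-row : ∀ {x y} → Point x y → ∃[ σ ]
    MonomialBlockRow (pow dim (γp c) m) (pairIndex x y) (pairIndex (p ℕ.∸ x) y) (above x y xor above (p ℕ.∸ x) y) σ
  γp^m-row {x} {y} pt@(1≤x , x<p , _) =
    ≡.subst (λ x′ → ∃[ σ ] MonomialBlockRow (pow dim (γp c) m) (pairIndex x y) (pairIndex x′ y) (above x y xor above x′ y) σ)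
      (Cp.fold-scale-half m (odd⇒half+half p p-odd) 1≤x x<p)
      (pow-monomialBlockRow pt m)
    where
    open Orbit dim (γp c) (λ x′ → Point x′ y) (λ x′ → pairIndex x′ y) (λ x′ → above x′ y) Cp.scale
               blockRow<dim Γp.scale-point
               (λ pt′ → fromBlocks-monomialBlockRow (γp-block c) _ _ _ (Γp.γp-block-point pt′))

  γq^n-row : ∀ {x y} → Point x y → ∃[ σ ]
    MonomialBlockRow (pow dim (γq d) n) (pairIndex x y) (pairIndex x (q ℕ.∸ y)) (above x y xor above x (q ℕ.∸ y)) σ
  γq^n-row {x} {y} pt@(_ , _ , 1≤y , y<q) =
    ≡.subst (λ y′ → ∃[ σ ] MonomialBlockRow (pow dim (γq d) n) (pairIndex x y) (pairIndex x y′) (above x y xor above x y′) σ)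
      (Cq.fold-scale-half n (odd⇒half+half q q-odd) 1≤y y<q)
      (pow-monomialBlockRow pt n)
    where
    open Orbit dim (γq d) (λ y′ → Point x y′) (pairIndex x) (above x) Cq.scale
               blockRow<dim Γq.scale-point
               (λ pt′ → fromBlocks-monomialBlockRow (γq-block d) _ _ _ (Γq.γq-block-point pt′))

  theMatrix-block : ∀ u v {x y} → Point x y → u (pairIndex x y) * v (pairIndex x y) ≈ 1# →
                    AntidiagonalBlock (theMatrix c d u v) (pairIndex x y)
  theMatrix-block u v {x} {y} pt uv≈1 with γp^m-row pt | γq^n-row (reflectˣ-point pt)
  ... | σ₁ , γp^m | σ₂ , γq^n = antidiagonalBlock (u i) (v i) ((σ₁ xor σ₂) xor (f₁ ∧ f₂)) uv≈1
    (diagonal-product-antidiagonal dim (diagU u v) (pow dim (γp c) m) (pow dim (γq d) n) _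
       (blockRow<dim pt) (blockRow<dim (reflectˣ-point pt)) (diagU-row u v i) γp^m
       (≡.subst (λ j → MonomialBlockRow (pow dim (γq d) n) (pairIndex (p ℕ.∸ x) y) j f₂ σ₂) (pairIndex-reflect pt) γq^n)
       flags)
    where
    i = pairIndex x y
    f₁ f₂ : Bool
    f₁ = above x y xor above (p ℕ.∸ x) y
    f₂ = above (p ℕ.∸ x) y xor above (p ℕ.∸ x) (q ℕ.∸ y)
    flags : f₁ xor f₂ ≡.≡ true
    flags = ≡.trans (xor-telescope (above x y) _ _)
                    (≡.trans (≡.cong (above x y xor_) (above-reflect pt)) (xor-inverseʳ (above x y)))

  antidiagonalBlocks : ∀ u v → (∀ i → i < g → u i * v i ≈ 1#) → ∀ i → i < g → AntidiagonalBlock (theMatrix c d u v) i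
  antidiagonalBlocks u v uv≈1 i i<g = at-point (pairIndex-surjective i<g)
    where
    at-point : (∃[ x ] ∃[ y ] Point x y × pairIndex x y ≡.≡ i) → AntidiagonalBlock (theMatrix c d u v) i
    at-point (x , y , pt , ≡.refl) = theMatrix-block u v pt (uv≈1 (pairIndex x y) (pairIndex<g pt))

  theorem : (u v : ℕ → Carrier) → (∀ i → i < g → u i * v i ≈ 1#) →
            charPoly dim (theMatrix c d u v) ≈ₚ (((Tₚ ^ₚ 2) +ₚ 1ₚ) ^ₚ g)
  theorem u v uv≈1 = charPoly-antidiagonal g (theMatrix c d u v) (antidiagonalBlocks u v uv≈1)

proposition5p2 : ∀ {c′ ℓ : Level} (R : CommutativeRing c′ ℓ) (p q : ℕ) →
    Prime p → Prime q → Odd p → Odd q → p ≢ q →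
    (c d : ℕ) → IsGenerator p c → IsGenerator q d →
    let open CommutativeRing R
        open OverRing R
        open OverRing.Mats R p q
    in (u v : ℕ → Carrier) → (∀ i → i < g → u i * v i ≈ 1#) →
       charPoly dim (theMatrix c d u v)
         ≈ₚ (((Tₚ ^ₚ 2) +ₚ 1ₚ) ^ₚ g)
proposition5p2 R zero     q        p-prime         = ⊥-elim (¬prime[0] p-prime)
proposition5p2 R (suc p₁) zero     p-prime q-prime = ⊥-elim (¬prime[0] q-prime)
proposition5p2 R (suc p₁) (suc q₁) p-prime q-prime p-odd q-odd p≢q c d c-generator d-generator =
  Proposition.theorem R p₁ q₁ p-prime q-prime p-odd q-odd p≢q
    (Arithmetic.odd-prime⇒2< p-prime p-odd) (Arithmetic.odd-prime⇒2< q-prime q-odd) c d c-generator d-generator
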